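{- Let $\mathfrak P$ be a finite set of integers and $(\lambda_i)_{i\in\mathfrak P}$ indeterminates; the weight of a walk on $\mathbb Z$ with steps in $\mathfrak P$ is the product of the $\lambda_i$ over its steps. For $i\ge1$, let $S_i$ be the generating function (sum of weights) of walks that start from $0$, end at $i$, and are at a positive level at every time after the start. Then for every $i\ge1$, $$\sum_{k=1}^i\frac{(-1)^{k-1}}{k}\sum_{\substack{i_1+\cdots+i_k=i\\ i_1>0,\dots,i_k>0}}S_{i_1}\cdots S_{i_k}=[x^i]\log\frac{1}{1-\sum_{j\in\mathfrak P}\lambda_jx^j}.$$
   Context: A walk on $\mathbb Z$ with steps in $\mathfrak P$ is a sequence $0=s_0,s_1,\dots,s_n$ with $s_k-s_{k-1}\in\mathfrak P$. -}

module Defs where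

open import Data.Nat as ℕ using (ℕ; zero; suc)
open import Data.Integer as ℤ using (ℤ; +_)
open import Data.Rational as ℚ using (ℚ; 0ℚ; 1ℚ)
open import Data.Fin using (Fin)
open import Data.Vec as Vec using (Vec; []; _∷_)
open import Data.Vec.Properties using (≡-dec)
open import Data.List as List using (List; []; _∷_; _++_; concatMap; upTo; allFin)
open import Data.Product using (_×_; _,_)
open import Data.Bool using (Bool; true; false; if_then_else_; _∧_)
open import Relation.Nullary.Decidable using (⌊_⌋)

-- The finite step set 𝔓 is given as an injective map P : Fin d → ℤ;
-- the indeterminate λ_j is indexed by j : Fin d (standing for λ_{P j}).

Mon : ℕ → Set
Mon d = Vec ℕ d

monEq : ∀ {d} → Mon d → Mon d → Bool
monEq m m′ = ⌊ ≡-dec ℕ._≟_ m m′ ⌋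

zeroMon : ∀ d → Mon d
zeroMon d = Vec.replicate d 0

unitMon : ∀ {d} → Fin d → Mon d
unitMon {d} j = Vec.updateAt (zeroMon d) j (λ _ → 1)

degree : ∀ {d} → Mon d → ℕ
degree = Vec.sum

Series : ℕ → Set
Series d = Mon d → ℚ

sumℚ : List ℚ → ℚ
sumℚ = List.foldr ℚ._+_ 0ℚ

splits : ∀ {d} → Mon d → List (Mon d × Mon d)
splits [] = ([] , []) ∷ []
splits (k ∷ m) =
  concatMap (λ a → List.map (λ { (u , v) → (a ∷ u , (k ℕ.∸ a) ∷ v) }) (splits m))
            (upTo (suc k))

_⊛_ : ∀ {d} → Series d → Series d → Series d
(f ⊛ g) m = sumℚ (List.map (λ { (a , b) → f a ℚ.* g b }) (splits m))

oneS : ∀ {d} → Series d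
oneS {d} m = if monEq m (zeroMon d) then 1ℚ else 0ℚ

prodS : ∀ {d} → List (Series d) → Series d
prodS = List.foldr _⊛_ oneS

-- Walks from 0: sequences of step indices.
Walk : ℕ → Set
Walk d = List (Fin d)

walksOfLength : ∀ d → ℕ → List (Walk d)
walksOfLength d zero = [] ∷ []
walksOfLength d (suc n) =
  concatMap (λ j → List.map (j ∷_) (walksOfLength d n)) (allFin d)

weightMon : ∀ {d} → Walk d → Mon d
weightMon {d} [] = zeroMon d
weightMon (j ∷ w) = Vec.updateAt (weightMon w) j suc

levelsFrom : ∀ {d} → (Fin d → ℤ) → ℤ → Walk d → List ℤ
levelsFrom P s [] = []
levelsFrom P s (j ∷ w) = (s ℤ.+ P j) ∷ levelsFrom P (s ℤ.+ P j) w

endpoint : ∀ {d} → (Fin d → ℤ) → Walk d → ℤ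
endpoint P w = List.foldl (λ s j → s ℤ.+ P j) (+ 0) w

allPositive : List ℤ → Bool
allPositive = List.foldr (λ s b → ⌊ ℤ.+ 0 ℤ.<? s ⌋ ∧ b) true

isPositiveWalkTo : ∀ {d} → (Fin d → ℤ) → ℕ → Walk d → Bool
isPositiveWalkTo P i w =
  ⌊ endpoint P w ℤ.≟ + i ⌋ ∧ allPositive (levelsFrom P (+ 0) w)

-- S_i = Σ_{walks w} weight(w).  Only walks with |m| steps have weight λ^m,
-- so the λ^m-coefficient is the (finite) sum over those walks.
S : ∀ {d} → (Fin d → ℤ) → ℕ → Series d
S {d} P i m = sumℚ (List.map
  (λ w → if isPositiveWalkTo P i w ∧ monEq (weightMon w) m then 1ℚ else 0ℚ)
  (walksOfLength d (degree m)))

compositions : ℕ → ℕ → List (List ℕ)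
compositions zero zero = [] ∷ []
compositions (suc i) zero = []
compositions i (suc k) =
  concatMap (λ a → List.map (suc a ∷_) (compositions (i ℕ.∸ suc a) k)) (upTo i)

sign : ℕ → ℚ
sign zero = 1ℚ
sign (suc n) = ℚ.- sign n

lhsSeries : ∀ {d} → (Fin d → ℤ) → ℕ → Series d
lhsSeries P i m = sumℚ (List.map
  (λ k′ → sign k′ ℚ.* ((+ 1) ℚ./ suc k′) ℚ.*
          sumℚ (List.map (λ c → prodS (List.map (S P) c) m) (compositions i (suc k′))))
  (upTo i))

-- Laurent polynomials in x with polynomial coefficients in λ, as formal
-- finite sums of terms  c · λ^m · x^e.
Poly : ℕ → Set
Poly d = List (ℚ × Mon d × ℤ)

_⊗_ : ∀ {d} → Poly d → Poly d → Poly d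
p ⊗ q = concatMap (λ { (c , m , e) →
          List.map (λ { (c′ , m′ , e′) → (c ℚ.* c′ , Vec.zipWith ℕ._+_ m m′ , e ℤ.+ e′) }) q }) p

onePoly : ∀ {d} → Poly d
onePoly {d} = (1ℚ , zeroMon d , + 0) ∷ []

_^P_ : ∀ {d} → Poly d → ℕ → Poly d
p ^P zero = onePoly
p ^P suc n = p ⊗ (p ^P n)

coeffP : ∀ {d} → Poly d → Mon d → ℤ → ℚ
coeffP p m e = sumℚ (List.map
  (λ { (c , m′ , e′) → if monEq m′ m ∧ ⌊ e′ ℤ.≟ e ⌋ then c else 0ℚ }) p)

-- F = Σ_{j ∈ 𝔓} λ_j x^j
stepPoly : ∀ {d} → (Fin d → ℤ) → Poly d
stepPoly {d} P = List.map (λ j → (1ℚ , unitMon j , P j)) (allFin d)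

-- λ^m-coefficient of [x^i] log (1/(1-F)) = [x^i] Σ_{n≥1} F^n / n.
-- F^n is homogeneous of λ-degree n, so only n ≤ |m| (indeed n = |m|) contribute.
logCoeff : ∀ {d} → (Fin d → ℤ) → ℕ → Series d
logCoeff P i m = sumℚ (List.map
  (λ n′ → ((+ 1) ℚ./ suc n′) ℚ.* coeffP (stepPoly P ^P suc n′) m (+ i))
  (upTo (degree m)))

{-# OPTIONS --safe #-}
module Submission where

-- Call a walk positive if all its levels after the start are > 0. Expanding S_{i₁}⋯S_{i_k}
-- walk by walk, the λ^m-coefficient of the left-hand side becomes a sum over the walks w to i
-- of weight λ^m of Σ_k (−1)^{k−1}/k · #{factorizations of w into k positive walks}. A nonempty
-- walk followed by a positive walk is positive iff the walk itself is, so for positive w such a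
-- factorization is a choice of k − 1 cut points among the c(w) positive proper suffixes of w,
-- and the inner sum is Σ_k (−1)^{k−1}/k · C(c(w), k−1) = 1/(c(w) + 1); for other w it is 0.
-- By the cycle lemma, a walk ending at a positive level has a positive rotation, and the
-- positive rotations of a positive w are w and the rotations starting at its positive proper
-- suffixes. So all positive rotations of a walk of length n ending at i > 0 have the same
-- c + 1, namely their number, and the weights 1/(c + 1) over its n rotations add up to 1.
-- Averaging over rotations turns the left-hand side into Σ_n (1/n)·#{walks of length n to i of
-- weight λ^m}, which is the λ^m-coefficient of [x^i] Σ_n F^n/n = [x^i] log 1/(1 − F).

open import Algebra.Bundles using (CommutativeMonoid)
import Algebra.Properties.CommutativeSemigroup as CommutativeSemigroupProperties
open import Data.Bool using (Bool; true; false; T; _∧_; if_then_else_)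
import Data.Bool.Properties as Bool
open import Data.Empty using (⊥-elim)
open import Data.Fin as Fin using (Fin)
open import Data.Integer as ℤ using (ℤ; -[1+_])
import Data.Integer.Properties as ℤ
open import Data.Integer.Tactic.RingSolver using (solve-∀)
open import Data.List as List using (List; []; _∷_; _++_; concatMap; upTo; applyUpTo; allFin; take; drop; length)
import Data.List.Properties as List
open import Data.Nat as ℕ using (ℕ; zero; suc; _≥_)
import Data.Nat.Properties as ℕ
open import Data.Product using (_×_; _,_; proj₁; proj₂; Σ-syntax)
open import Data.Rational as ℚ using (ℚ; 0ℚ; 1ℚ; _+_; _*_; -_)
import Data.Rational.Properties as ℚ
open import Data.Rational.Solver using (module +-*-Solver)
import Data.Rational.Unnormalised as ℚᵘ
import Data.Rational.Unnormalised.Properties as ℚᵘ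
open import Data.Unit using (⊤)
open import Data.Vec as Vec using ([]; _∷_)
import Data.Vec.Properties as Vec
open import Function using (_∘_)
open import Function.Bundles using (mk⇔)
open import Relation.Binary.PropositionalEquality
open import Relation.Nullary using (yes; no; ¬_)
open import Relation.Nullary.Decidable
  using (Dec; ⌊_⌋; toWitness; fromWitness; isYes≗does; dec-true; dec-false; does-⇔)

open import Defs

open +-*-Solver
open CommutativeSemigroupProperties (CommutativeMonoid.commutativeSemigroup ℕ.+-0-commutativeMonoid)
  using () renaming (interchange to ℕ+-interchange)
open CommutativeSemigroupProperties (CommutativeMonoid.commutativeSemigroup ℚ.+-0-commutativeMonoid)
  using () renaming (interchange to +-interchange)
open CommutativeSemigroupProperties (CommutativeMonoid.commutativeSemigroup ℚ.*-1-commutativeMonoid)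
  using (xy∙z≈y∙xz; x∙yz≈yx∙z) renaming (interchange to *-interchange; x∙yz≈y∙xz to *-left-comm)

∑ : {A : Set} → List A → (A → ℚ) → ℚ
∑ []       f = 0ℚ
∑ (x ∷ xs) f = f x + ∑ xs f

infix 5 ∑
syntax ∑ xs (λ x → e) = ∑[ x ∈ xs ] e

∑< : ℕ → (ℕ → ℚ) → ℚ
∑< zero    f = 0ℚ
∑< (suc n) f = f 0 + ∑< n (f ∘ suc)

infix 5 ∑<
syntax ∑< n (λ k → e) = ∑[ k < n ] e

private
  variable
    A B : Set

sumℚ-map : (f : A → ℚ) (xs : List A) → sumℚ (List.map f xs) ≡ ∑ xs f
sumℚ-map f []       = refl
sumℚ-map f (x ∷ xs) = cong (f x +_) (sumℚ-map f xs)

∑-cong : (xs : List A) {f g : A → ℚ} → (∀ x → f x ≡ g x) → ∑ xs f ≡ ∑ xs g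
∑-cong []       f≗g = refl
∑-cong (x ∷ xs) f≗g = cong₂ _+_ (f≗g x) (∑-cong xs f≗g)

∑-zero : (xs : List A) {f : A → ℚ} → (∀ x → f x ≡ 0ℚ) → ∑ xs f ≡ 0ℚ
∑-zero []       f≗0 = refl
∑-zero (x ∷ xs) f≗0 = cong₂ _+_ (f≗0 x) (∑-zero xs f≗0)

∑-++ : (xs ys : List A) (f : A → ℚ) → ∑ (xs ++ ys) f ≡ ∑ xs f + ∑ ys f
∑-++ []       ys f = sym (ℚ.+-identityˡ _)
∑-++ (x ∷ xs) ys f = trans (cong (f x +_) (∑-++ xs ys f)) (sym (ℚ.+-assoc (f x) _ _))

∑-map : (g : A → B) (xs : List A) (f : B → ℚ) → ∑ (List.map g xs) f ≡ ∑ xs (f ∘ g)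
∑-map g []       f = refl
∑-map g (x ∷ xs) f = cong (f (g x) +_) (∑-map g xs f)

∑-concatMap : (g : A → List B) (xs : List A) (f : B → ℚ) →
              ∑ (concatMap g xs) f ≡ ∑[ x ∈ xs ] ∑ (g x) f
∑-concatMap g []       f = refl
∑-concatMap g (x ∷ xs) f =
  trans (∑-++ (g x) (concatMap g xs) f) (cong (∑ (g x) f +_) (∑-concatMap g xs f))

∑-+ : (xs : List A) (f g : A → ℚ) → ∑[ x ∈ xs ] (f x + g x) ≡ ∑ xs f + ∑ xs g
∑-+ []       f g = refl
∑-+ (x ∷ xs) f g = trans (cong (f x + g x +_) (∑-+ xs f g)) (+-interchange (f x) (g x) _ _)

∑-*ˡ : (xs : List A) (c : ℚ) (f : A → ℚ) → ∑[ x ∈ xs ] (c * f x) ≡ c * ∑ xs f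
∑-*ˡ []       c f = sym (ℚ.*-zeroʳ c)
∑-*ˡ (x ∷ xs) c f = trans (cong (c * f x +_) (∑-*ˡ xs c f)) (sym (ℚ.*-distribˡ-+ c (f x) _))

∑-*ʳ : (xs : List A) (c : ℚ) (f : A → ℚ) → ∑[ x ∈ xs ] (f x * c) ≡ ∑ xs f * c
∑-*ʳ xs c f = trans (∑-cong xs (λ x → ℚ.*-comm (f x) c)) (trans (∑-*ˡ xs c f) (ℚ.*-comm c _))

∑-swap : (xs : List A) (ys : List B) (f : A → B → ℚ) →
         ∑[ x ∈ xs ] ∑[ y ∈ ys ] f x y ≡ ∑[ y ∈ ys ] ∑[ x ∈ xs ] f x y
∑-swap []       ys f = sym (∑-zero ys (λ _ → refl))
∑-swap (x ∷ xs) ys f = trans (cong (∑ ys (f x) +_) (∑-swap xs ys f)) (sym (∑-+ ys (f x) _))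

∑-applyUpTo : (g : ℕ → ℕ) (n : ℕ) (f : ℕ → ℚ) → ∑ (applyUpTo g n) f ≡ ∑< n (f ∘ g)
∑-applyUpTo g zero    f = refl
∑-applyUpTo g (suc n) f = cong (f (g 0) +_) (∑-applyUpTo (g ∘ suc) n f)

∑-upTo : (n : ℕ) (f : ℕ → ℚ) → ∑ (upTo n) f ≡ ∑< n f
∑-upTo = ∑-applyUpTo (λ k → k)

∑<-cong : (n : ℕ) {f g : ℕ → ℚ} → (∀ k → k ℕ.< n → f k ≡ g k) → ∑< n f ≡ ∑< n g
∑<-cong zero    f≗g = refl
∑<-cong (suc n) f≗g = cong₂ _+_ (f≗g 0 ℕ.z<s) (∑<-cong n (λ k k<n → f≗g (suc k) (ℕ.s<s k<n)))

∑<-zero : (n : ℕ) {f : ℕ → ℚ} → (∀ k → k ℕ.< n → f k ≡ 0ℚ) → ∑< n f ≡ 0ℚ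
∑<-zero zero    f≗0 = refl
∑<-zero (suc n) f≗0 = cong₂ _+_ (f≗0 0 ℕ.z<s) (∑<-zero n (λ k k<n → f≗0 (suc k) (ℕ.s<s k<n)))

∑<-delta : (n k₀ : ℕ) (f : ℕ → ℚ) → k₀ ℕ.< n → (∀ k → k ≢ k₀ → f k ≡ 0ℚ) → ∑< n f ≡ f k₀
∑<-delta (suc n) zero     f _         f≗0 =
  trans (cong (f 0 +_) (∑<-zero n (λ k _ → f≗0 (suc k) (λ ())))) (ℚ.+-identityʳ (f 0))
∑<-delta (suc n) (suc k₀) f (ℕ.s<s k₀<n) f≗0 =
  trans (cong (_+ ∑< n (f ∘ suc)) (f≗0 0 (λ ())))
        (trans (ℚ.+-identityˡ _) (∑<-delta n k₀ (f ∘ suc) k₀<n (λ k k≢k₀ → f≗0 (suc k) (k≢k₀ ∘ ℕ.suc-injective))))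

∑<-+ : (m n : ℕ) (f : ℕ → ℚ) → ∑< (m ℕ.+ n) f ≡ ∑< m f + (∑[ k < n ] f (m ℕ.+ k))
∑<-+ zero    n f = sym (ℚ.+-identityˡ _)
∑<-+ (suc m) n f = trans (cong (f 0 +_) (∑<-+ m n (f ∘ suc))) (sym (ℚ.+-assoc (f 0) _ _))

∑<-snoc : (n : ℕ) (f : ℕ → ℚ) → ∑< (suc n) f ≡ ∑< n f + f n
∑<-snoc zero    f = trans (ℚ.+-identityʳ (f 0)) (sym (ℚ.+-identityˡ (f 0)))
∑<-snoc (suc n) f = trans (cong (f 0 +_) (∑<-snoc n (f ∘ suc))) (sym (ℚ.+-assoc (f 0) _ _))

∑<-*ˡ : (n : ℕ) (c : ℚ) (f : ℕ → ℚ) → ∑[ k < n ] (c * f k) ≡ c * ∑< n f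
∑<-*ˡ n c f = trans (sym (∑-upTo n _)) (trans (∑-*ˡ (upTo n) c f) (cong (c *_) (∑-upTo n f)))

∑<-*ʳ : (n : ℕ) (c : ℚ) (f : ℕ → ℚ) → ∑[ k < n ] (f k * c) ≡ ∑< n f * c
∑<-*ʳ n c f = trans (sym (∑-upTo n _)) (trans (∑-*ʳ (upTo n) c f) (cong (_* c) (∑-upTo n f)))

∑-∑<-swap : (xs : List A) (n : ℕ) (f : A → ℕ → ℚ) →
            ∑[ x ∈ xs ] ∑[ k < n ] f x k ≡ ∑[ k < n ] ∑[ x ∈ xs ] f x k
∑-∑<-swap xs n f = begin
  ∑[ x ∈ xs ] ∑< n (f x)            ≡⟨ ∑-cong xs (λ x → sym (∑-upTo n (f x))) ⟩
  ∑[ x ∈ xs ] ∑ (upTo n) (f x)      ≡⟨ ∑-swap xs (upTo n) f ⟩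
  ∑[ k ∈ upTo n ] ∑[ x ∈ xs ] f x k ≡⟨ ∑-upTo n _ ⟩
  ∑[ k < n ] ∑[ x ∈ xs ] f x k      ∎
  where open ≡-Reasoning

∑-*-∑ : (xs : List A) (ys : List B) (f : A → ℚ) (g : B → ℚ) →
        ∑ xs f * ∑ ys g ≡ ∑[ x ∈ xs ] ∑[ y ∈ ys ] (f x * g y)
∑-*-∑ xs ys f g = trans (sym (∑-*ʳ xs (∑ ys g) f)) (∑-cong xs (λ x → sym (∑-*ˡ ys (f x) g)))

𝟙 : Bool → ℚ
𝟙 b = if b then 1ℚ else 0ℚ

𝟙-∧ : (a b : Bool) → 𝟙 (a ∧ b) ≡ 𝟙 a * 𝟙 b
𝟙-∧ true  b = sym (ℚ.*-identityˡ (𝟙 b))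
𝟙-∧ false b = sym (ℚ.*-zeroˡ (𝟙 b))

𝟙*-cong : (b : Bool) {x y : ℚ} → (T b → x ≡ y) → 𝟙 b * x ≡ 𝟙 b * y
𝟙*-cong true  x≡y = cong (1ℚ *_) (x≡y _)
𝟙*-cong false {x} {y} _ = trans (ℚ.*-zeroˡ x) (sym (ℚ.*-zeroˡ y))

T⇒≡true : {b : Bool} → T b → b ≡ true
T⇒≡true {true} _ = refl

T-∧-intro : {a b : Bool} → T a → T b → T (a ∧ b)
T-∧-intro {true} _ tb = tb

T-∧-elim : {a b : Bool} → T (a ∧ b) → T a × T b
T-∧-elim {true} tb = _ , tb

T-⇔⇒≡ : {a b : Bool} → (T a → T b) → (T b → T a) → a ≡ b
T-⇔⇒≡ {true}  {true}  _ _ = refl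
T-⇔⇒≡ {true}  {false} f _ = ⊥-elim (f _)
T-⇔⇒≡ {false} {true}  _ g = ⊥-elim (g _)
T-⇔⇒≡ {false} {false} _ _ = refl

𝟙*-zero : (b : Bool) {x : ℚ} → (T b → x ≡ 0ℚ) → 𝟙 b * x ≡ 0ℚ
𝟙*-zero true  {x} x≡0 = trans (ℚ.*-identityˡ x) (x≡0 _)
𝟙*-zero false {x} _   = ℚ.*-zeroˡ x

𝟙-¬T : {b : Bool} → ¬ T b → 𝟙 b ≡ 0ℚ
𝟙-¬T {true}  ¬tb = ⊥-elim (¬tb _)
𝟙-¬T {false} _   = refl

⌊⌋-⇔ : {X Y : Set} (x? : Dec X) (y? : Dec Y) → (X → Y) → (Y → X) → ⌊ x? ⌋ ≡ ⌊ y? ⌋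
⌊⌋-⇔ x? y? to from = trans (isYes≗does x?) (trans (does-⇔ (mk⇔ to from) x? y?) (sym (isYes≗does y?)))

𝟙-⌊⌋-yes : {X : Set} (x? : Dec X) → X → 𝟙 ⌊ x? ⌋ ≡ 1ℚ
𝟙-⌊⌋-yes x? x = cong 𝟙 (T⇒≡true (fromWitness {a? = x?} x))

𝟙-⌊⌋-no : {X : Set} (x? : Dec X) → ¬ X → 𝟙 ⌊ x? ⌋ ≡ 0ℚ
𝟙-⌊⌋-no x? ¬x = 𝟙-¬T (¬x ∘ toWitness)

∑<-𝟙≟-𝟙≟ : (k x y : ℕ) → ∑[ a < suc k ] 𝟙 ⌊ x ℕ.≟ a ⌋ * 𝟙 ⌊ y ℕ.≟ k ℕ.∸ a ⌋ ≡ 𝟙 ⌊ x ℕ.+ y ℕ.≟ k ⌋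
∑<-𝟙≟-𝟙≟ k x y with x ℕ.≤? k
... | yes x≤k = begin
  ∑[ a < suc k ] 𝟙 ⌊ x ℕ.≟ a ⌋ * 𝟙 ⌊ y ℕ.≟ k ℕ.∸ a ⌋
    ≡⟨ ∑<-delta (suc k) x _ (ℕ.s≤s x≤k) (λ a a≢x →
         trans (cong (_* 𝟙 ⌊ y ℕ.≟ k ℕ.∸ a ⌋) (𝟙-⌊⌋-no (x ℕ.≟ a) (a≢x ∘ sym)))
               (ℚ.*-zeroˡ (𝟙 ⌊ y ℕ.≟ k ℕ.∸ a ⌋))) ⟩
  𝟙 ⌊ x ℕ.≟ x ⌋ * 𝟙 ⌊ y ℕ.≟ k ℕ.∸ x ⌋
    ≡⟨ trans (cong (_* 𝟙 ⌊ y ℕ.≟ k ℕ.∸ x ⌋) (𝟙-⌊⌋-yes (x ℕ.≟ x) refl)) (ℚ.*-identityˡ _) ⟩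
  𝟙 ⌊ y ℕ.≟ k ℕ.∸ x ⌋
    ≡⟨ cong 𝟙 (⌊⌋-⇔ (y ℕ.≟ k ℕ.∸ x) (x ℕ.+ y ℕ.≟ k)
         (λ y≡k-x → trans (cong (x ℕ.+_) y≡k-x) (ℕ.m+[n∸m]≡n x≤k))
         (λ x+y≡k → trans (sym (ℕ.m+n∸m≡n x y)) (cong (ℕ._∸ x) x+y≡k))) ⟩
  𝟙 ⌊ x ℕ.+ y ℕ.≟ k ⌋ ∎
  where open ≡-Reasoning
... | no x≰k = trans
  (∑<-zero (suc k) (λ a a<1+k → trans
     (cong (_* 𝟙 ⌊ y ℕ.≟ k ℕ.∸ a ⌋) (𝟙-⌊⌋-no (x ℕ.≟ a) (λ x≡a → x≰k (ℕ.≤-pred (subst (ℕ._< suc k) (sym x≡a) a<1+k)))))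
     (ℚ.*-zeroˡ (𝟙 ⌊ y ℕ.≟ k ℕ.∸ a ⌋))))
  (sym (𝟙-⌊⌋-no (x ℕ.+ y ℕ.≟ k) (λ x+y≡k → x≰k (subst (x ℕ.≤_) x+y≡k (ℕ.m≤m+n x y)))))

∑<-𝟙≟ℤ-𝟙≟ℤ : (i : ℕ) (x y : ℤ) → ℤ.0ℤ ℤ.≤ y →
  ∑[ a < i ] 𝟙 ⌊ x ℤ.≟ ℤ.+ suc a ⌋ * 𝟙 ⌊ y ℤ.≟ ℤ.+ (i ℕ.∸ suc a) ⌋ ≡
  𝟙 ⌊ ℤ.0ℤ ℤ.<? x ⌋ * 𝟙 ⌊ x ℤ.+ y ℤ.≟ ℤ.+ i ⌋
∑<-𝟙≟ℤ-𝟙≟ℤ i -[1+ n ]        y _ =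
  trans (∑<-zero i (λ a _ → ℚ.*-zeroˡ (𝟙 ⌊ y ℤ.≟ ℤ.+ (i ℕ.∸ suc a) ⌋)))
        (sym (ℚ.*-zeroˡ (𝟙 ⌊ -[1+ n ] ℤ.+ y ℤ.≟ ℤ.+ i ⌋)))
∑<-𝟙≟ℤ-𝟙≟ℤ i (ℤ.+ zero)     y _ =
  trans (∑<-zero i (λ a _ → ℚ.*-zeroˡ (𝟙 ⌊ y ℤ.≟ ℤ.+ (i ℕ.∸ suc a) ⌋)))
        (sym (ℚ.*-zeroˡ (𝟙 ⌊ ℤ.+ 0 ℤ.+ y ℤ.≟ ℤ.+ i ⌋)))
∑<-𝟙≟ℤ-𝟙≟ℤ zero (ℤ.+ suc x) (ℤ.+ y) _ = refl
∑<-𝟙≟ℤ-𝟙≟ℤ (suc i) (ℤ.+ suc x) (ℤ.+ y) _ = begin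
  ∑[ a < suc i ] 𝟙 ⌊ ℤ.+ suc x ℤ.≟ ℤ.+ suc a ⌋ * 𝟙 ⌊ ℤ.+ y ℤ.≟ ℤ.+ (i ℕ.∸ a) ⌋
    ≡⟨ ∑<-cong (suc i) (λ a _ → cong₂ (λ u v → 𝟙 u * 𝟙 v)
         (⌊⌋-⇔ (ℤ.+ suc x ℤ.≟ ℤ.+ suc a) (x ℕ.≟ a) (ℕ.suc-injective ∘ ℤ.+-injective) (cong (λ n → ℤ.+ suc n)))
         (⌊⌋-⇔ (ℤ.+ y ℤ.≟ ℤ.+ (i ℕ.∸ a)) (y ℕ.≟ i ℕ.∸ a) ℤ.+-injective (cong (λ n → ℤ.+ n)))) ⟩
  ∑[ a < suc i ] 𝟙 ⌊ x ℕ.≟ a ⌋ * 𝟙 ⌊ y ℕ.≟ i ℕ.∸ a ⌋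
    ≡⟨ ∑<-𝟙≟-𝟙≟ i x y ⟩
  𝟙 ⌊ x ℕ.+ y ℕ.≟ i ⌋
    ≡⟨ cong 𝟙 (⌊⌋-⇔ (x ℕ.+ y ℕ.≟ i) (ℤ.+ suc x ℤ.+ ℤ.+ y ℤ.≟ ℤ.+ suc i)
                   (cong (λ n → ℤ.+ suc n)) (ℕ.suc-injective ∘ ℤ.+-injective)) ⟩
  𝟙 ⌊ ℤ.+ suc x ℤ.+ ℤ.+ y ℤ.≟ ℤ.+ suc i ⌋
    ≡⟨ sym (ℚ.*-identityˡ _) ⟩
  1ℚ * 𝟙 ⌊ ℤ.+ suc x ℤ.+ ℤ.+ y ℤ.≟ ℤ.+ suc i ⌋ ∎
  where open ≡-Reasoning

0<i⇒i+j<1+k⇒j<k : ∀ {i j} k → ℤ.0ℤ ℤ.< i → i ℤ.+ j ℤ.< ℤ.+ suc k → j ℤ.< ℤ.+ k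
0<i⇒i+j<1+k⇒j<k {i} {j} k 0<i i+j<1+k with j ℤ.<? ℤ.+ k
... | yes j<k = j<k
... | no  j≮k = ⊥-elim (ℤ.<-irrefl refl (ℤ.≤-<-trans (ℤ.+-mono-≤ (ℤ.i<j⇒suc[i]≤j 0<i) (ℤ.≮⇒≥ j≮k)) i+j<1+k))

-- Binomial coefficients

fromℕ : ℕ → ℚ
fromℕ zero    = 0ℚ
fromℕ (suc n) = 1ℚ + fromℕ n

fromℕ-+ : (m n : ℕ) → fromℕ (m ℕ.+ n) ≡ fromℕ m + fromℕ n
fromℕ-+ zero    n = sym (ℚ.+-identityˡ _)
fromℕ-+ (suc m) n = trans (cong (1ℚ +_) (fromℕ-+ m n)) (sym (ℚ.+-assoc 1ℚ (fromℕ m) (fromℕ n)))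

∑<-const : (n : ℕ) (c : ℚ) → ∑[ _ < n ] c ≡ fromℕ n * c
∑<-const zero    c = sym (ℚ.*-zeroˡ c)
∑<-const (suc n) c = trans (cong (c +_) (∑<-const n c))
  (solve 2 (λ c x → c :+ x :* c := (con 1ℚ :+ x) :* c) refl c (fromℕ n))

1/[1+_] : ℕ → ℚ
1/[1+ n ] = ℤ.+ 1 ℚ./ suc n

fromℕ-toℚᵘ : (n : ℕ) → ℚ.toℚᵘ (fromℕ n) ℚᵘ.≃ ℚᵘ.mkℚᵘ (ℤ.+ n) 0
fromℕ-toℚᵘ zero    = ℚᵘ.*≡* refl
fromℕ-toℚᵘ (suc n) = ℚᵘ.≃-trans (ℚ.toℚᵘ-homo-+ 1ℚ (fromℕ n))
  (ℚᵘ.≃-trans (ℚᵘ.+-congʳ (ℚ.toℚᵘ 1ℚ) (fromℕ-toℚᵘ n)) (ℚᵘ.*≡* (lemma (ℤ.+ n))))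
  where
  lemma : ∀ x → (ℤ.+ 1 ℤ.* ℤ.+ 1 ℤ.+ x ℤ.* ℤ.+ 1) ℤ.* ℤ.+ 1 ≡ (ℤ.+ 1 ℤ.+ x) ℤ.* (ℤ.+ 1 ℤ.* ℤ.+ 1)
  lemma = solve-∀

1/[1+n]*[1+n]≡1 : (n : ℕ) → 1/[1+ n ] * fromℕ (suc n) ≡ 1ℚ
1/[1+n]*[1+n]≡1 n = ℚ.toℚᵘ-injective (ℚᵘ.≃-trans (ℚ.toℚᵘ-homo-* 1/[1+ n ] (fromℕ (suc n)))
  (ℚᵘ.≃-trans (ℚᵘ.*-cong (ℚ.toℚᵘ-fromℚᵘ (ℚᵘ.mkℚᵘ (ℤ.+ 1) n)) (fromℕ-toℚᵘ (suc n)))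
  (ℚᵘ.*≡* (lemma (ℤ.+ suc n)))))
  where
  lemma : ∀ x → (ℤ.+ 1 ℤ.* x) ℤ.* ℤ.+ 1 ≡ ℤ.+ 1 ℤ.* (x ℤ.* ℤ.+ 1)
  lemma = solve-∀

binomial : ℕ → ℕ → ℚ
binomial n       zero    = 1ℚ
binomial zero    (suc k) = 0ℚ
binomial (suc n) (suc k) = binomial n k + binomial n (suc k)

binomial-vanishes : ∀ n k → n ℕ.< k → binomial n k ≡ 0ℚ
binomial-vanishes zero    (suc k) _           = refl
binomial-vanishes (suc n) (suc k) (ℕ.s<s n<k) =
  trans (cong₂ _+_ (binomial-vanishes n k n<k) (binomial-vanishes n (suc k) (ℕ.m<n⇒m<1+n n<k)))
        (ℚ.+-identityˡ 0ℚ)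

binomial-1 : ∀ n → binomial n 1 ≡ fromℕ n
binomial-1 zero    = refl
binomial-1 (suc n) = cong (1ℚ +_) (binomial-1 n)

binomial-absorption : ∀ n k → fromℕ (suc k) * binomial (suc n) (suc k) ≡ fromℕ (suc n) * binomial n k
binomial-absorption zero    zero    = refl
binomial-absorption zero    (suc k) = trans (ℚ.*-zeroʳ (fromℕ (2 ℕ.+ k))) (sym (ℚ.*-zeroʳ (fromℕ 1)))
binomial-absorption (suc n) zero    = trans (cong (λ z → fromℕ 1 * (1ℚ + z)) (binomial-1 (suc n)))
  (solve 1 (λ x → (con 1ℚ :+ con 0ℚ) :* (con 1ℚ :+ x) := (con 1ℚ :+ x) :* con 1ℚ) refl (fromℕ (suc n)))
binomial-absorption (suc n) (suc k) = begin
  (1ℚ + a) * ((x + y) + z)          ≡⟨ solve 4 (λ a x y z → (con 1ℚ :+ a) :* ((x :+ y) :+ z)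
                                                         := ((x :+ y) :+ a :* (x :+ y)) :+ (con 1ℚ :+ a) :* z)
                                               refl a x y z ⟩
  ((x + y) + a * (x + y)) + (1ℚ + a) * z
    ≡⟨ cong₂ (λ u v → ((x + y) + u) + v) (binomial-absorption n k) (binomial-absorption n (suc k)) ⟩
  ((x + y) + b * x) + b * y         ≡⟨ solve 3 (λ b x y → ((x :+ y) :+ b :* x) :+ b :* y := (con 1ℚ :+ b) :* (x :+ y))
                                               refl b x y ⟩
  (1ℚ + b) * (x + y)                ∎
  where
  open ≡-Reasoning
  a = fromℕ (suc k)
  b = fromℕ (suc n)
  x = binomial n k
  y = binomial n (suc k)
  z = binomial (suc n) (suc (suc k))

binomial-absorption-1/[1+_] : ∀ n k → 1/[1+ k ] * binomial n k ≡ 1/[1+ n ] * binomial (suc n) (suc k)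
binomial-absorption-1/[1+_] n k = begin
  1/[1+ k ] * x                                  ≡⟨ sym (trans (cong ((1/[1+ k ] * x) *_) (1/[1+n]*[1+n]≡1 n))
                                                                (ℚ.*-identityʳ _)) ⟩
  (1/[1+ k ] * x) * (1/[1+ n ] * fromℕ (suc n))  ≡⟨ solve 4 (λ p q x m → (p :* x) :* (q :* m) := (q :* p) :* (m :* x))
                                                          refl 1/[1+ k ] 1/[1+ n ] x (fromℕ (suc n)) ⟩
  (1/[1+ n ] * 1/[1+ k ]) * (fromℕ (suc n) * x)  ≡⟨ cong ((1/[1+ n ] * 1/[1+ k ]) *_) (sym (binomial-absorption n k)) ⟩
  (1/[1+ n ] * 1/[1+ k ]) * (fromℕ (suc k) * y)  ≡⟨ solve 4 (λ q p m y → (q :* p) :* (m :* y) := (q :* y) :* (p :* m))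
                                                          refl 1/[1+ n ] 1/[1+ k ] (fromℕ (suc k)) y ⟩
  (1/[1+ n ] * y) * (1/[1+ k ] * fromℕ (suc k))  ≡⟨ trans (cong ((1/[1+ n ] * y) *_) (1/[1+n]*[1+n]≡1 k))
                                                          (ℚ.*-identityʳ _) ⟩
  1/[1+ n ] * y                                  ∎
  where
  open ≡-Reasoning
  x = binomial n k
  y = binomial (suc n) (suc k)

∑-sign*binomial : ∀ n m → ∑[ k < suc m ] sign k * binomial (suc n) k ≡ sign m * binomial n m
∑-sign*binomial n zero    = refl
∑-sign*binomial n (suc m) = begin
  ∑[ k < suc (suc m) ] sign k * binomial (suc n) k
    ≡⟨ ∑<-snoc (suc m) (λ k → sign k * binomial (suc n) k) ⟩
  (∑[ k < suc m ] sign k * binomial (suc n) k) + sign (suc m) * binomial (suc n) (suc m)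
    ≡⟨ cong (_+ sign (suc m) * binomial (suc n) (suc m)) (∑-sign*binomial n m) ⟩
  sign m * binomial n m + (- sign m) * (binomial n m + binomial n (suc m))
    ≡⟨ solve 3 (λ s x y → s :* x :+ (:- s) :* (x :+ y) := (:- s) :* y) refl (sign m) (binomial n m) (binomial n (suc m)) ⟩
  sign (suc m) * binomial n (suc m) ∎
  where open ≡-Reasoning

∑-sign*binomial-suc : ∀ n m → n ℕ.< m → ∑[ k < m ] sign k * binomial (suc n) (suc k) ≡ 1ℚ
∑-sign*binomial-suc n m n<m = begin
  Σ                         ≡⟨ solve 1 (λ t → t := con 1ℚ :+ (:- (con 1ℚ :+ (:- con 1ℚ) :* t))) refl Σ ⟩
  1ℚ + - (1ℚ + (- 1ℚ) * Σ)  ≡⟨ cong (λ z → 1ℚ + - (1ℚ + z)) (sym (∑<-*ˡ m (- 1ℚ) _)) ⟩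
  1ℚ + - (1ℚ + (∑[ k < m ] (- 1ℚ) * (sign k * binomial (suc n) (suc k))))
    ≡⟨ cong (λ z → 1ℚ + - (1ℚ + z)) (∑<-cong m (λ k _ →
         solve 2 (λ s x → (:- con 1ℚ) :* (s :* x) := (:- s) :* x) refl (sign k) (binomial (suc n) (suc k)))) ⟩
  1ℚ + - (∑[ k < suc m ] sign k * binomial (suc n) k)
    ≡⟨ cong (λ z → 1ℚ + - z) (trans (∑-sign*binomial n m)
         (trans (cong (sign m *_) (binomial-vanishes n m n<m)) (ℚ.*-zeroʳ (sign m)))) ⟩
  1ℚ + - 0ℚ                 ≡⟨⟩
  1ℚ                        ∎
  where
  open ≡-Reasoning
  Σ = ∑[ k < m ] sign k * binomial (suc n) (suc k)

-- ∫₀¹ (1 − x)ⁿ dx = 1/(n + 1), with (1 − x)ⁿ expanded.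
∑-sign*binomial/[1+k] : ∀ n m → n ℕ.< m → ∑[ k < m ] sign k * 1/[1+ k ] * binomial n k ≡ 1/[1+ n ]
∑-sign*binomial/[1+k] n m n<m = begin
  ∑[ k < m ] sign k * 1/[1+ k ] * binomial n k
    ≡⟨ ∑<-cong m (λ k _ → trans (ℚ.*-assoc (sign k) 1/[1+ k ] (binomial n k))
         (trans (cong (sign k *_) (binomial-absorption-1/[1+_] n k)) (*-left-comm (sign k) 1/[1+ n ] _))) ⟩
  ∑[ k < m ] 1/[1+ n ] * (sign k * binomial (suc n) (suc k))
    ≡⟨ ∑<-*ˡ m 1/[1+ n ] _ ⟩
  1/[1+ n ] * (∑[ k < m ] sign k * binomial (suc n) (suc k))
    ≡⟨ trans (cong (1/[1+ n ] *_) (∑-sign*binomial-suc n m n<m)) (ℚ.*-identityʳ 1/[1+ n ]) ⟩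
  1/[1+ n ] ∎
  where open ≡-Reasoning

-- Splittings, rotations and factorizations of lists

boolToℕ : Bool → ℕ
boolToℕ b = if b then 1 else 0

count< : ℕ → (ℕ → Bool) → ℕ
count< zero    p = 0
count< (suc n) p = boolToℕ (p 0) ℕ.+ count< n (p ∘ suc)

count<-+ : (m n : ℕ) (p : ℕ → Bool) → count< (m ℕ.+ n) p ≡ count< m p ℕ.+ count< n (λ k → p (m ℕ.+ k))
count<-+ zero    n p = refl
count<-+ (suc m) n p = trans (cong (boolToℕ (p 0) ℕ.+_) (count<-+ m n (p ∘ suc))) (sym (ℕ.+-assoc (boolToℕ (p 0)) _ _))

count<-cong : (n : ℕ) {p q : ℕ → Bool} → (∀ k → k ℕ.< n → p k ≡ q k) → count< n p ≡ count< n q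
count<-cong zero    p≗q = refl
count<-cong (suc n) p≗q = cong₂ ℕ._+_ (cong boolToℕ (p≗q 0 ℕ.z<s)) (count<-cong n (λ k k<n → p≗q (suc k) (ℕ.s<s k<n)))

count<-pos : (n k : ℕ) (p : ℕ → Bool) → k ℕ.< n → T (p k) → 1 ℕ.≤ count< n p
count<-pos (suc n) zero    p _           pk with p 0
... | true = ℕ.s≤s ℕ.z≤n
count<-pos (suc n) (suc k) p (ℕ.s<s k<n) pk = ℕ.≤-trans (count<-pos n k (p ∘ suc) k<n pk) (ℕ.m≤n+m _ (boolToℕ (p 0)))

∑<-𝟙 : (n : ℕ) (p : ℕ → Bool) → ∑[ k < n ] 𝟙 (p k) ≡ fromℕ (count< n p)
∑<-𝟙 zero    p = refl
∑<-𝟙 (suc n) p = trans (cong₂ _+_ (𝟙≡fromℕ (p 0)) (∑<-𝟙 n (p ∘ suc))) (sym (fromℕ-+ (boolToℕ (p 0)) _))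
  where
  𝟙≡fromℕ : ∀ b → 𝟙 b ≡ fromℕ (boolToℕ b)
  𝟙≡fromℕ true  = refl
  𝟙≡fromℕ false = refl

∑++ : List A → (List A → List A → ℚ) → ℚ
∑++ []      φ = φ [] []
∑++ (a ∷ w) φ = φ [] (a ∷ w) + ∑++ w (λ x y → φ (a ∷ x) y)

infix 5 ∑++
syntax ∑++ w (λ x y → e) = ∑[ x ++ y ≔ w ] e

∑++-cong : (w : List A) {φ ψ : List A → List A → ℚ} →
           (∀ x y → x ++ y ≡ w → φ x y ≡ ψ x y) → ∑++ w φ ≡ ∑++ w ψ
∑++-cong []      φ≗ψ = φ≗ψ [] [] refl
∑++-cong (a ∷ w) φ≗ψ = cong₂ _+_ (φ≗ψ [] (a ∷ w) refl) (∑++-cong w (λ x y eq → φ≗ψ (a ∷ x) y (cong (a ∷_) eq)))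

∑++-zero : (w : List A) {φ : List A → List A → ℚ} → (∀ x y → x ++ y ≡ w → φ x y ≡ 0ℚ) → ∑++ w φ ≡ 0ℚ
∑++-zero []      φ≗0 = φ≗0 [] [] refl
∑++-zero (a ∷ w) φ≗0 =
  trans (cong₂ _+_ (φ≗0 [] (a ∷ w) refl) (∑++-zero w (λ x y eq → φ≗0 (a ∷ x) y (cong (a ∷_) eq))))
        (ℚ.+-identityˡ 0ℚ)

∑++-*ˡ : (w : List A) (c : ℚ) (φ : List A → List A → ℚ) → c * ∑++ w φ ≡ ∑[ x ++ y ≔ w ] (c * φ x y)
∑++-*ˡ []      c φ = refl
∑++-*ˡ (a ∷ w) c φ = trans (ℚ.*-distribˡ-+ c _ _) (cong (c * φ [] (a ∷ w) +_) (∑++-*ˡ w c _))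

∑-∑++-swap : (xs : List B) (w : List A) (φ : B → List A → List A → ℚ) →
             ∑[ b ∈ xs ] ∑++ w (φ b) ≡ ∑[ x ++ y ≔ w ] ∑[ b ∈ xs ] φ b x y
∑-∑++-swap xs []      φ = refl
∑-∑++-swap xs (a ∷ w) φ =
  trans (∑-+ xs _ _) (cong ((∑[ b ∈ xs ] φ b [] (a ∷ w)) +_) (∑-∑++-swap xs w (λ b x y → φ b (a ∷ x) y)))

∑<-∑++-swap : (n : ℕ) (w : List A) (φ : ℕ → List A → List A → ℚ) →
              ∑[ k < n ] ∑++ w (φ k) ≡ ∑[ x ++ y ≔ w ] ∑[ k < n ] φ k x y
∑<-∑++-swap n w φ = trans (sym (∑-upTo n _))
  (trans (∑-∑++-swap (upTo n) w φ) (∑++-cong w (λ x y _ → ∑-upTo n _)))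

∑++-[] : (w : List A) (f : List A → ℚ) → ∑[ x ++ y ≔ w ] (f x * 𝟙 (List.null y)) ≡ f w
∑++-[] []      f = ℚ.*-identityʳ (f [])
∑++-[] (a ∷ w) f =
  trans (cong (_+ (∑[ x ++ y ≔ w ] f (a ∷ x) * 𝟙 (List.null y))) (ℚ.*-zeroʳ (f [])))
        (trans (ℚ.+-identityˡ _) (∑++-[] w (f ∘ (a ∷_))))

take-++-length : (x y : List A) (u : ℕ) → take (length x ℕ.+ u) (x ++ y) ≡ x ++ take u y
take-++-length []      y u = refl
take-++-length (a ∷ x) y u = cong (a ∷_) (take-++-length x y u)

drop-++-length : (x y : List A) (u : ℕ) → drop (length x ℕ.+ u) (x ++ y) ≡ drop u y
drop-++-length []      y u = refl
drop-++-length (a ∷ x) y u = drop-++-length x y u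

take-++-≤ : (x y : List A) (u : ℕ) → u ℕ.≤ length x → take u (x ++ y) ≡ take u x
take-++-≤ x       y zero    _           = refl
take-++-≤ (a ∷ x) y (suc u) (ℕ.s≤s u≤x) = cong (a ∷_) (take-++-≤ x y u u≤x)

drop-++-≤ : (x y : List A) (u : ℕ) → u ℕ.≤ length x → drop u (x ++ y) ≡ drop u x ++ y
drop-++-≤ x       y zero    _           = refl
drop-++-≤ (a ∷ x) y (suc u) (ℕ.s≤s u≤x) = drop-++-≤ x y u u≤x

drop-<-length : (s : ℕ) (v : List A) → s ℕ.< length v → Σ[ a ∈ A ] Σ[ y ∈ List A ] drop s v ≡ a ∷ y
drop-<-length zero    (a ∷ v) _           = a , v , refl
drop-<-length (suc s) (a ∷ v) (ℕ.s<s s<v) = drop-<-length s v s<v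

rotate : ℕ → List A → List A
rotate t w = drop t w ++ take t w

rotate-length : (x y : List A) → rotate (length x) (x ++ y) ≡ y ++ x
rotate-length x y = begin
  drop (length x) (x ++ y) ++ take (length x) (x ++ y)
    ≡⟨ cong (λ n → drop n (x ++ y) ++ take n (x ++ y)) (sym (ℕ.+-identityʳ (length x))) ⟩
  drop (length x ℕ.+ 0) (x ++ y) ++ take (length x ℕ.+ 0) (x ++ y)
    ≡⟨ cong₂ _++_ (drop-++-length x y 0) (take-++-length x y 0) ⟩
  y ++ x ++ []
    ≡⟨ cong (y ++_) (List.++-identityʳ x) ⟩
  y ++ x ∎
  where open ≡-Reasoning

rotate-++ : (x y : List A) (u : ℕ) → u ℕ.≤ length y → rotate u (y ++ x) ≡ rotate (length x ℕ.+ u) (x ++ y)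
rotate-++ x y u u≤y = begin
  drop u (y ++ x) ++ take u (y ++ x)  ≡⟨ cong₂ _++_ (drop-++-≤ y x u u≤y) (take-++-≤ y x u u≤y) ⟩
  (drop u y ++ x) ++ take u y         ≡⟨ List.++-assoc (drop u y) x (take u y) ⟩
  drop u y ++ x ++ take u y           ≡⟨ sym (cong₂ _++_ (drop-++-length x y u) (take-++-length x y u)) ⟩
  rotate (length x ℕ.+ u) (x ++ y)    ∎
  where open ≡-Reasoning

rotate-invariant : (h : List A → B) {_∙_ : B → B → B} → (∀ x y → h (x ++ y) ≡ h x ∙ h y) →
                   (∀ a b → a ∙ b ≡ b ∙ a) → ∀ t w → h (rotate t w) ≡ h w
rotate-invariant h {_∙_} h-++ ∙-comm t w = begin
  h (drop t w ++ take t w)    ≡⟨ h-++ (drop t w) (take t w) ⟩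
  h (drop t w) ∙ h (take t w) ≡⟨ ∙-comm (h (drop t w)) (h (take t w)) ⟩
  h (take t w) ∙ h (drop t w) ≡⟨ sym (h-++ (take t w) (drop t w)) ⟩
  h (take t w ++ drop t w)    ≡⟨ cong h (List.take++drop≡id t w) ⟩
  h w                         ∎
  where open ≡-Reasoning

rotationCount : (List A → Bool) → List A → ℕ
rotationCount p w = count< (length w) (λ t → p (rotate t w))

rotationCount-++-comm : (p : List A → Bool) (x y : List A) → rotationCount p (y ++ x) ≡ rotationCount p (x ++ y)
rotationCount-++-comm p x y = begin
  count< (length (y ++ x)) (λ t → p (rotate t (y ++ x)))
    ≡⟨ cong (λ n → count< n (λ t → p (rotate t (y ++ x)))) (List.length-++ y) ⟩
  count< (length y ℕ.+ length x) (λ t → p (rotate t (y ++ x)))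
    ≡⟨ count<-+ (length y) (length x) _ ⟩
  count< (length y) (λ t → p (rotate t (y ++ x))) ℕ.+ count< (length x) (λ t → p (rotate (length y ℕ.+ t) (y ++ x)))
    ≡⟨ cong₂ ℕ._+_ (count<-cong (length y) (λ u u<y → cong p (rotate-++ x y u (ℕ.<⇒≤ u<y))))
                   (count<-cong (length x) (λ u u<x → cong p (sym (rotate-++ y x u (ℕ.<⇒≤ u<x))))) ⟩
  count< (length y) (λ t → p (rotate (length x ℕ.+ t) (x ++ y))) ℕ.+ count< (length x) (λ t → p (rotate t (x ++ y)))
    ≡⟨ ℕ.+-comm (count< (length y) _) _ ⟩
  count< (length x) (λ t → p (rotate t (x ++ y))) ℕ.+ count< (length y) (λ t → p (rotate (length x ℕ.+ t) (x ++ y)))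
    ≡⟨ sym (count<-+ (length x) (length y) _) ⟩
  count< (length x ℕ.+ length y) (λ t → p (rotate t (x ++ y)))
    ≡⟨ cong (λ n → count< n (λ t → p (rotate t (x ++ y)))) (sym (List.length-++ x)) ⟩
  count< (length (x ++ y)) (λ t → p (rotate t (x ++ y))) ∎
  where open ≡-Reasoning

rotationCount-rotate : (p : List A → Bool) (t : ℕ) (w : List A) → rotationCount p (rotate t w) ≡ rotationCount p w
rotationCount-rotate p t w =
  trans (rotationCount-++-comm p (take t w) (drop t w)) (cong (rotationCount p) (List.take++drop≡id t w))

suffixCount : (List A → Bool) → List A → ℕ
suffixCount p []      = 0
suffixCount p (a ∷ v) = boolToℕ (p (a ∷ v)) ℕ.+ suffixCount p v

suffixCount-count< : (p : List A → Bool) (v : List A) → suffixCount p v ≡ count< (length v) (λ s → p (drop s v))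
suffixCount-count< p []      = refl
suffixCount-count< p (a ∷ v) = cong (boolToℕ (p (a ∷ v)) ℕ.+_) (suffixCount-count< p v)

suffixCount-≤ : (p : List A → Bool) (v : List A) → suffixCount p v ℕ.≤ length v
suffixCount-≤ p []      = ℕ.z≤n
suffixCount-≤ p (a ∷ v) with p (a ∷ v)
... | true  = ℕ.s≤s (suffixCount-≤ p v)
... | false = ℕ.m≤n⇒m≤1+n (suffixCount-≤ p v)

factorizations : (List A → Bool) → ℕ → List A → ℚ
factorizations p zero    w = 𝟙 (List.null w)
factorizations p (suc k) w = ∑[ x ++ y ≔ w ] 𝟙 (p x) * factorizations p k y

module _ (p : List A → Bool) (¬p[] : ¬ T (p [])) where

  ∑++-𝟙*binomial : (k : ℕ) (v : List A) →
    ∑[ x ++ y ≔ v ] 𝟙 (p y) * binomial (suffixCount p (drop 1 y)) k ≡ binomial (suffixCount p v) (suc k)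
  ∑++-𝟙*binomial k []      = trans (cong (_* binomial 0 k) (𝟙-¬T ¬p[])) (ℚ.*-zeroˡ (binomial 0 k))
  ∑++-𝟙*binomial k (a ∷ v) with p (a ∷ v)
  ... | true  = cong₂ _+_ (ℚ.*-identityˡ (binomial (suffixCount p v) k)) (∑++-𝟙*binomial k v)
  ... | false = trans (cong₂ _+_ (ℚ.*-zeroˡ (binomial (suffixCount p v) k)) (∑++-𝟙*binomial k v)) (ℚ.+-identityˡ _)

  -- Given p-++, a factorization of a p-list w into k + 1 p-lists is the same as a choice of k
  -- proper suffixes of w satisfying p, at which w is cut.
  factorizations-suc : (∀ a x y → T (p y) → p (a ∷ x) ≡ p ((a ∷ x) ++ y)) →
    (k : ℕ) (w : List A) → factorizations p (suc k) w ≡ 𝟙 (p w) * binomial (suffixCount p (drop 1 w)) k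
  factorizations-suc p-++ zero    w       = trans (∑++-[] w (𝟙 ∘ p)) (sym (ℚ.*-identityʳ (𝟙 (p w))))
  factorizations-suc p-++ (suc k) []      =
    trans (cong (_* factorizations p (suc k) []) (𝟙-¬T ¬p[]))
      (trans (ℚ.*-zeroˡ (factorizations p (suc k) []))
             (sym (trans (cong (_* binomial 0 (suc k)) (𝟙-¬T ¬p[])) (ℚ.*-zeroˡ (binomial 0 (suc k))))))
  factorizations-suc p-++ (suc k) (a ∷ v) = begin
    𝟙 (p []) * factorizations p (suc k) (a ∷ v) + (∑[ x ++ y ≔ v ] 𝟙 (p (a ∷ x)) * factorizations p (suc k) y)
      ≡⟨ cong₂ _+_ (trans (cong (_* factorizations p (suc k) (a ∷ v)) (𝟙-¬T ¬p[]))
                          (ℚ.*-zeroˡ (factorizations p (suc k) (a ∷ v))))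
                   (∑++-cong v (λ x y _ → cong (𝟙 (p (a ∷ x)) *_) (factorizations-suc p-++ k y))) ⟩
    0ℚ + (∑[ x ++ y ≔ v ] 𝟙 (p (a ∷ x)) * (𝟙 (p y) * binomial (suffixCount p (drop 1 y)) k))
      ≡⟨ ℚ.+-identityˡ _ ⟩
    ∑[ x ++ y ≔ v ] 𝟙 (p (a ∷ x)) * (𝟙 (p y) * binomial (suffixCount p (drop 1 y)) k)
      ≡⟨ ∑++-cong v (λ x y x++y≡v → prefix-irrelevant x y x++y≡v) ⟩
    ∑[ x ++ y ≔ v ] 𝟙 (p (a ∷ v)) * (𝟙 (p y) * binomial (suffixCount p (drop 1 y)) k)
      ≡⟨ sym (∑++-*ˡ v (𝟙 (p (a ∷ v))) _) ⟩
    𝟙 (p (a ∷ v)) * (∑[ x ++ y ≔ v ] 𝟙 (p y) * binomial (suffixCount p (drop 1 y)) k)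
      ≡⟨ cong (𝟙 (p (a ∷ v)) *_) (∑++-𝟙*binomial k v) ⟩
    𝟙 (p (a ∷ v)) * binomial (suffixCount p v) (suc k) ∎
    where
    open ≡-Reasoning
    prefix-irrelevant : ∀ x y → x ++ y ≡ v →
      𝟙 (p (a ∷ x)) * (𝟙 (p y) * binomial (suffixCount p (drop 1 y)) k) ≡
      𝟙 (p (a ∷ v)) * (𝟙 (p y) * binomial (suffixCount p (drop 1 y)) k)
    prefix-irrelevant x y x++y≡v =
      trans (*-left-comm (𝟙 (p (a ∷ x))) (𝟙 (p y)) C)
        (trans (𝟙*-cong (p y) (λ py → cong (λ b → 𝟙 b * C) (trans (p-++ a x y py) (cong (p ∘ (a ∷_)) x++y≡v))))
               (*-left-comm (𝟙 (p y)) (𝟙 (p (a ∷ v))) C))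
      where
      C = binomial (suffixCount p (drop 1 y)) k

_⊕_ : {d : ℕ} → Mon d → Mon d → Mon d
_⊕_ = Vec.zipWith ℕ._+_

⊕-comm : {d : ℕ} (a b : Mon d) → a ⊕ b ≡ b ⊕ a
⊕-comm = Vec.zipWith-comm ℕ.+-comm

⊕-identityˡ : {d : ℕ} (a : Mon d) → zeroMon d ⊕ a ≡ a
⊕-identityˡ = Vec.zipWith-identityˡ ℕ.+-identityˡ

degree-⊕ : {d : ℕ} (a b : Mon d) → degree (a ⊕ b) ≡ degree a ℕ.+ degree b
degree-⊕ []      []      = refl
degree-⊕ (x ∷ a) (y ∷ b) = trans (cong (x ℕ.+ y ℕ.+_) (degree-⊕ a b)) (ℕ+-interchange x y (degree a) (degree b))

degree-zeroMon : ∀ d → degree (zeroMon d) ≡ 0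
degree-zeroMon zero    = refl
degree-zeroMon (suc d) = degree-zeroMon d

degree≡0⇒zeroMon : {d : ℕ} (a : Mon d) → degree a ≡ 0 → a ≡ zeroMon d
degree≡0⇒zeroMon []           _  = refl
degree≡0⇒zeroMon (zero ∷ a) deg≡0 = cong (0 ∷_) (degree≡0⇒zeroMon a deg≡0)

updateAt-suc-⊕ : {d : ℕ} (j : Fin d) (a b : Mon d) → Vec.updateAt (a ⊕ b) j suc ≡ Vec.updateAt a j suc ⊕ b
updateAt-suc-⊕ Fin.zero    (x ∷ a) (y ∷ b) = refl
updateAt-suc-⊕ (Fin.suc j) (x ∷ a) (y ∷ b) = cong (x ℕ.+ y ∷_) (updateAt-suc-⊕ j a b)

updateAt-suc≡unitMon-⊕ : {d : ℕ} (j : Fin d) (a : Mon d) → Vec.updateAt a j suc ≡ unitMon j ⊕ a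
updateAt-suc≡unitMon-⊕ Fin.zero    (x ∷ a) = cong (suc x ∷_) (sym (⊕-identityˡ a))
updateAt-suc≡unitMon-⊕ (Fin.suc j) (x ∷ a) = cong (x ∷_) (updateAt-suc≡unitMon-⊕ j a)

degree-updateAt-suc : {d : ℕ} (j : Fin d) (a : Mon d) → degree (Vec.updateAt a j suc) ≡ suc (degree a)
degree-updateAt-suc Fin.zero    (x ∷ a) = refl
degree-updateAt-suc (Fin.suc j) (x ∷ a) = trans (cong (x ℕ.+_) (degree-updateAt-suc j a)) (ℕ.+-suc x _)

monEq-refl : {d : ℕ} (a : Mon d) → monEq a a ≡ true
monEq-refl a = trans (isYes≗does (Vec.≡-dec ℕ._≟_ a a)) (dec-true (Vec.≡-dec ℕ._≟_ a a) refl)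

monEq-≢ : {d : ℕ} (a b : Mon d) → a ≢ b → monEq a b ≡ false
monEq-≢ a b a≢b = trans (isYes≗does (Vec.≡-dec ℕ._≟_ a b)) (dec-false (Vec.≡-dec ℕ._≟_ a b) a≢b)

monEq-∷ : {d : ℕ} (x y : ℕ) (a b : Mon d) → monEq (x ∷ a) (y ∷ b) ≡ (⌊ x ℕ.≟ y ⌋ ∧ monEq a b)
monEq-∷ x y a b with x ℕ.≟ y | Vec.≡-dec ℕ._≟_ a b
... | yes _ | yes _ = refl
... | yes _ | no  _ = refl
... | no  _ | _     = refl

weightMon-++ : {d : ℕ} (x y : Walk d) → weightMon (x ++ y) ≡ weightMon x ⊕ weightMon y
weightMon-++ []      y = sym (⊕-identityˡ (weightMon y))
weightMon-++ (j ∷ x) y =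
  trans (cong (λ a → Vec.updateAt a j suc) (weightMon-++ x y)) (updateAt-suc-⊕ j (weightMon x) (weightMon y))

degree-weightMon : {d : ℕ} (w : Walk d) → degree (weightMon w) ≡ length w
degree-weightMon {d} []      = degree-zeroMon d
degree-weightMon (j ∷ w) = trans (degree-updateAt-suc j (weightMon w)) (cong suc (degree-weightMon w))

weightMon-rotate : {d : ℕ} (t : ℕ) (w : Walk d) → weightMon (rotate t w) ≡ weightMon w
weightMon-rotate = rotate-invariant weightMon weightMon-++ ⊕-comm

module _ {d : ℕ} where

  ∑-walksOfLength-suc : (n : ℕ) (f : Walk d → ℚ) →
    ∑ (walksOfLength d (suc n)) f ≡ ∑[ j ∈ allFin d ] ∑[ w ∈ walksOfLength d n ] f (j ∷ w)
  ∑-walksOfLength-suc n f =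
    trans (∑-concatMap _ (allFin d) f) (∑-cong (allFin d) (λ j → ∑-map (j ∷_) (walksOfLength d n) f))

  ∑-walksOfLength-cong : (n : ℕ) {f g : Walk d → ℚ} → (∀ w → length w ≡ n → f w ≡ g w) →
                         ∑ (walksOfLength d n) f ≡ ∑ (walksOfLength d n) g
  ∑-walksOfLength-cong zero    f≗g = cong (_+ 0ℚ) (f≗g [] refl)
  ∑-walksOfLength-cong (suc n) {f} {g} f≗g = begin
    ∑ (walksOfLength d (suc n)) f                          ≡⟨ ∑-walksOfLength-suc n f ⟩
    ∑[ j ∈ allFin d ] ∑[ w ∈ walksOfLength d n ] f (j ∷ w)
      ≡⟨ ∑-cong (allFin d) (λ j → ∑-walksOfLength-cong n (λ w |w|≡n → f≗g (j ∷ w) (cong suc |w|≡n))) ⟩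
    ∑[ j ∈ allFin d ] ∑[ w ∈ walksOfLength d n ] g (j ∷ w) ≡⟨ sym (∑-walksOfLength-suc n g) ⟩
    ∑ (walksOfLength d (suc n)) g                          ∎
    where open ≡-Reasoning

  ∑-walksOfLength-zero : (n : ℕ) {f : Walk d → ℚ} → (∀ w → length w ≡ n → f w ≡ 0ℚ) →
                         ∑ (walksOfLength d n) f ≡ 0ℚ
  ∑-walksOfLength-zero n f≗0 = trans (∑-walksOfLength-cong n f≗0) (∑-zero (walksOfLength d n) (λ _ → refl))

  ∑-walksOfLength-+ : (t r : ℕ) (φ : Walk d → Walk d → ℚ) →
    ∑[ w ∈ walksOfLength d (t ℕ.+ r) ] φ (take t w) (drop t w) ≡
    ∑[ u ∈ walksOfLength d t ] ∑[ v ∈ walksOfLength d r ] φ u v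
  ∑-walksOfLength-+ zero    r φ = sym (ℚ.+-identityʳ _)
  ∑-walksOfLength-+ (suc t) r φ =
    trans (∑-walksOfLength-suc (t ℕ.+ r) _)
      (trans (∑-cong (allFin d) (λ j → ∑-walksOfLength-+ t r (λ u v → φ (j ∷ u) v)))
             (sym (∑-walksOfLength-suc t _)))

  ∑-walksOfLength-rotate : (n t : ℕ) (f : Walk d → ℚ) → t ℕ.≤ n →
                           ∑[ w ∈ walksOfLength d n ] f (rotate t w) ≡ ∑ (walksOfLength d n) f
  ∑-walksOfLength-rotate n t f t≤n =
    subst (λ n → ∑[ w ∈ walksOfLength d n ] f (rotate t w) ≡ ∑ (walksOfLength d n) f)
          (ℕ.m+[n∸m]≡n t≤n) (rotate-sum (n ℕ.∸ t))
    where
    open ≡-Reasoning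
    rotate-sum : ∀ r → ∑[ w ∈ walksOfLength d (t ℕ.+ r) ] f (rotate t w) ≡ ∑ (walksOfLength d (t ℕ.+ r)) f
    rotate-sum r = begin
      ∑[ w ∈ walksOfLength d (t ℕ.+ r) ] f (drop t w ++ take t w)
        ≡⟨ ∑-walksOfLength-+ t r (λ u v → f (v ++ u)) ⟩
      ∑[ u ∈ walksOfLength d t ] ∑[ v ∈ walksOfLength d r ] f (v ++ u)
        ≡⟨ ∑-swap (walksOfLength d t) (walksOfLength d r) _ ⟩
      ∑[ v ∈ walksOfLength d r ] ∑[ u ∈ walksOfLength d t ] f (v ++ u)
        ≡⟨ sym (∑-walksOfLength-+ r t (λ v u → f (v ++ u))) ⟩
      ∑[ w ∈ walksOfLength d (r ℕ.+ t) ] f (take r w ++ drop r w)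
        ≡⟨ ∑-cong (walksOfLength d (r ℕ.+ t)) (λ w → cong f (List.take++drop≡id r w)) ⟩
      ∑ (walksOfLength d (r ℕ.+ t)) f
        ≡⟨ cong (λ n → ∑ (walksOfLength d n) f) (ℕ.+-comm r t) ⟩
      ∑ (walksOfLength d (t ℕ.+ r)) f ∎

  ∑-walksOfLength-∑++ : (n : ℕ) (φ : Walk d → Walk d → ℚ) →
    ∑[ w ∈ walksOfLength d n ] ∑++ w φ ≡
    ∑[ t < suc n ] ∑[ u ∈ walksOfLength d t ] ∑[ v ∈ walksOfLength d (n ℕ.∸ t) ] φ u v
  ∑-walksOfLength-∑++ zero    φ = sym (trans (ℚ.+-identityʳ ((φ [] [] + 0ℚ) + 0ℚ)) (ℚ.+-identityʳ (φ [] [] + 0ℚ)))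
  ∑-walksOfLength-∑++ (suc n) φ = begin
    ∑[ w ∈ walksOfLength d (suc n) ] ∑++ w φ
      ≡⟨ ∑-walksOfLength-suc n _ ⟩
    ∑[ j ∈ allFin d ] ∑[ w ∈ walksOfLength d n ] (φ [] (j ∷ w) + ∑++ w (φ ∘ (j ∷_)))
      ≡⟨ ∑-cong (allFin d) (λ j → ∑-+ (walksOfLength d n) _ _) ⟩
    ∑[ j ∈ allFin d ] ((∑[ w ∈ walksOfLength d n ] φ [] (j ∷ w)) + (∑[ w ∈ walksOfLength d n ] ∑++ w (φ ∘ (j ∷_))))
      ≡⟨ ∑-+ (allFin d) _ _ ⟩
    (∑[ j ∈ allFin d ] ∑[ w ∈ walksOfLength d n ] φ [] (j ∷ w)) +
    (∑[ j ∈ allFin d ] ∑[ w ∈ walksOfLength d n ] ∑++ w (φ ∘ (j ∷_)))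
      ≡⟨ cong₂ _+_ (sym (∑-walksOfLength-suc n _)) (∑-cong (allFin d) (λ j → ∑-walksOfLength-∑++ n (φ ∘ (j ∷_)))) ⟩
    ∑ (walksOfLength d (suc n)) (φ []) +
    (∑[ j ∈ allFin d ] ∑[ t < suc n ] ∑[ u ∈ walksOfLength d t ] ∑[ v ∈ walksOfLength d (n ℕ.∸ t) ] φ (j ∷ u) v)
      ≡⟨ cong₂ _+_ (sym (ℚ.+-identityʳ (∑ (walksOfLength d (suc n)) (φ []))))
           (trans (∑-∑<-swap (allFin d) (suc n) (λ j t →
                    ∑[ u ∈ walksOfLength d t ] ∑[ v ∈ walksOfLength d (n ℕ.∸ t) ] φ (j ∷ u) v))
                  (∑<-cong (suc n) (λ t _ → sym (∑-walksOfLength-suc t (λ u →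
                    ∑[ v ∈ walksOfLength d (n ℕ.∸ t) ] φ u v))))) ⟩
    ∑[ t < suc (suc n) ] ∑[ u ∈ walksOfLength d t ] ∑[ v ∈ walksOfLength d (suc n ℕ.∸ t) ] φ u v ∎
    where open ≡-Reasoning

module _ {d : ℕ} where

  ⊛-as-∑ : (f g : Series d) (m : Mon d) → (f ⊛ g) m ≡ ∑[ p ∈ splits m ] f (proj₁ p) * g (proj₂ p)
  ⊛-as-∑ f g m = trans (sumℚ-map _ (splits m)) (∑-cong (splits m) (λ { (a , b) → refl }))

  ⊛-cong : {f f′ g g′ : Series d} → (∀ a → f a ≡ f′ a) → (∀ b → g b ≡ g′ b) → ∀ m → (f ⊛ g) m ≡ (f′ ⊛ g′) m
  ⊛-cong {f} {f′} {g} {g′} f≗f′ g≗g′ m = trans (⊛-as-∑ f g m)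
    (trans (∑-cong (splits m) (λ p → cong₂ _*_ (f≗f′ (proj₁ p)) (g≗g′ (proj₂ p)))) (sym (⊛-as-∑ f′ g′ m)))

∑-splits-∷ : {d : ℕ} (k : ℕ) (m : Mon d) (f : Mon (suc d) × Mon (suc d) → ℚ) →
  ∑ (splits (k ∷ m)) f ≡ ∑[ a < suc k ] ∑[ p ∈ splits m ] f (a ∷ proj₁ p , (k ℕ.∸ a) ∷ proj₂ p)
∑-splits-∷ k m f = begin
  ∑ (splits (k ∷ m)) f
    ≡⟨ cong (λ ps → ∑ ps f) (List.concatMap-cong (λ a → List.map-cong (λ { (u , v) → refl }) (splits m)) (upTo (suc k))) ⟩
  ∑ (concatMap (λ a → List.map (cons a) (splits m)) (upTo (suc k))) f
    ≡⟨ ∑-concatMap (λ a → List.map (cons a) (splits m)) (upTo (suc k)) f ⟩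
  ∑[ a ∈ upTo (suc k) ] ∑ (List.map (cons a) (splits m)) f
    ≡⟨ ∑-cong (upTo (suc k)) (λ a → ∑-map (cons a) (splits m) f) ⟩
  ∑[ a ∈ upTo (suc k) ] ∑[ p ∈ splits m ] f (cons a p)
    ≡⟨ ∑-upTo (suc k) (λ a → ∑[ p ∈ splits m ] f (cons a p)) ⟩
  ∑[ a < suc k ] ∑[ p ∈ splits m ] f (cons a p) ∎
  where
  open ≡-Reasoning
  cons : ℕ → Mon _ × Mon _ → Mon _ × Mon _
  cons a p = a ∷ proj₁ p , (k ℕ.∸ a) ∷ proj₂ p

∑-splits-cong : {d : ℕ} (m : Mon d) {f g : Mon d × Mon d → ℚ} →
  (∀ a b → a ⊕ b ≡ m → f (a , b) ≡ g (a , b)) → ∑ (splits m) f ≡ ∑ (splits m) g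
∑-splits-cong []      f≗g = cong (_+ 0ℚ) (f≗g [] [] refl)
∑-splits-cong (k ∷ m) {f} {g} f≗g =
  trans (∑-splits-∷ k m f) (trans (∑<-cong (suc k) (λ a a<1+k → ∑-splits-cong m (λ u v u⊕v≡m →
    f≗g (a ∷ u) ((k ℕ.∸ a) ∷ v) (cong₂ _∷_ (ℕ.m+[n∸m]≡n (ℕ.≤-pred a<1+k)) u⊕v≡m)))) (sym (∑-splits-∷ k m g)))

∑-splits-𝟙 : {d : ℕ} (m x y : Mon d) →
  ∑[ p ∈ splits m ] 𝟙 (monEq x (proj₁ p)) * 𝟙 (monEq y (proj₂ p)) ≡ 𝟙 (monEq (x ⊕ y) m)
∑-splits-𝟙 []      []       []       = refl
∑-splits-𝟙 (k ∷ m) (x₀ ∷ x) (y₀ ∷ y) = begin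
  ∑ (splits (k ∷ m)) F
    ≡⟨ ∑-splits-∷ k m F ⟩
  ∑[ a < suc k ] ∑[ p ∈ splits m ] F (a ∷ proj₁ p , (k ℕ.∸ a) ∷ proj₂ p)
    ≡⟨ ∑<-cong (suc k) (λ a _ → trans (∑-cong (splits m) (λ p → split-𝟙 a (proj₁ p) (proj₂ p)))
         (trans (∑-*ˡ (splits m) (c a) _) (cong (c a *_) (∑-splits-𝟙 m x y)))) ⟩
  ∑[ a < suc k ] c a * 𝟙 (monEq (x ⊕ y) m)
    ≡⟨ trans (∑<-*ʳ (suc k) _ c) (cong (_* 𝟙 (monEq (x ⊕ y) m)) (∑<-𝟙≟-𝟙≟ k x₀ y₀)) ⟩
  𝟙 ⌊ x₀ ℕ.+ y₀ ℕ.≟ k ⌋ * 𝟙 (monEq (x ⊕ y) m)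
    ≡⟨ sym (trans (cong 𝟙 (monEq-∷ (x₀ ℕ.+ y₀) k (x ⊕ y) m)) (𝟙-∧ ⌊ x₀ ℕ.+ y₀ ℕ.≟ k ⌋ (monEq (x ⊕ y) m))) ⟩
  𝟙 (monEq ((x₀ ∷ x) ⊕ (y₀ ∷ y)) (k ∷ m)) ∎
  where
  open ≡-Reasoning
  c : ℕ → ℚ
  c a = 𝟙 ⌊ x₀ ℕ.≟ a ⌋ * 𝟙 ⌊ y₀ ℕ.≟ k ℕ.∸ a ⌋
  F : Mon _ × Mon _ → ℚ
  F p = 𝟙 (monEq (x₀ ∷ x) (proj₁ p)) * 𝟙 (monEq (y₀ ∷ y) (proj₂ p))
  split-𝟙 : ∀ a u v → F (a ∷ u , (k ℕ.∸ a) ∷ v) ≡ c a * (𝟙 (monEq x u) * 𝟙 (monEq y v))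
  split-𝟙 a u v = trans
    (cong₂ _*_ (trans (cong 𝟙 (monEq-∷ x₀ a x u)) (𝟙-∧ ⌊ x₀ ℕ.≟ a ⌋ (monEq x u)))
               (trans (cong 𝟙 (monEq-∷ y₀ (k ℕ.∸ a) y v)) (𝟙-∧ ⌊ y₀ ℕ.≟ k ℕ.∸ a ⌋ (monEq y v))))
    (*-interchange (𝟙 ⌊ x₀ ℕ.≟ a ⌋) (𝟙 (monEq x u)) (𝟙 ⌊ y₀ ℕ.≟ k ℕ.∸ a ⌋) (𝟙 (monEq y v)))

module _ {d : ℕ} where

  -- The series Σ_w G(w) λ^{weight(w)}; only walks of length |m| have weight λ^m.
  walkSeries : (Walk d → ℚ) → Series d
  walkSeries G m = ∑[ w ∈ walksOfLength d (degree m) ] 𝟙 (monEq (weightMon w) m) * G w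

  monEq-weightMon-≢ : (w : Walk d) (a : Mon d) → length w ≢ degree a → monEq (weightMon w) a ≡ false
  monEq-weightMon-≢ w a |w|≢|a| = monEq-≢ (weightMon w) a (λ eq → |w|≢|a| (trans (sym (degree-weightMon w)) (cong degree eq)))

  module _ (F G : Walk d → ℚ) where

    private
      term : Mon d → Mon d → Walk d → Walk d → ℚ
      term a b u v = (𝟙 (monEq (weightMon u) a) * 𝟙 (monEq (weightMon v) b)) * (F u * G v)

      ∑ᵗᵘᵛ : (Walk d → Walk d → ℚ) → ℕ → ℚ
      ∑ᵗᵘᵛ φ n = ∑[ t < suc n ] ∑[ u ∈ walksOfLength d t ] ∑[ v ∈ walksOfLength d (n ℕ.∸ t) ] φ u v

    walkSeries-* : (a b : Mon d) → walkSeries F a * walkSeries G b ≡ ∑ᵗᵘᵛ (term a b) (degree (a ⊕ b))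
    walkSeries-* a b = begin
      walkSeries F a * walkSeries G b
        ≡⟨ ∑-*-∑ (walksOfLength d (degree a)) (walksOfLength d (degree b)) _ _ ⟩
      ∑[ u ∈ walksOfLength d (degree a) ] ∑[ v ∈ walksOfLength d (degree b) ]
        ((𝟙 (monEq (weightMon u) a) * F u) * (𝟙 (monEq (weightMon v) b) * G v))
        ≡⟨ ∑-cong (walksOfLength d (degree a)) (λ u → ∑-cong (walksOfLength d (degree b)) (λ v →
             *-interchange (𝟙 (monEq (weightMon u) a)) (F u) (𝟙 (monEq (weightMon v) b)) (G v))) ⟩
      ∑[ u ∈ walksOfLength d (degree a) ] ∑[ v ∈ walksOfLength d (degree b) ] term a b u v
        ≡⟨ cong (λ r → ∑[ u ∈ walksOfLength d (degree a) ] ∑[ v ∈ walksOfLength d r ] term a b u v) |b|≡n∸|a| ⟩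
      ∑[ u ∈ walksOfLength d (degree a) ] ∑[ v ∈ walksOfLength d (n ℕ.∸ degree a) ] term a b u v
        ≡⟨ sym (∑<-delta (suc n) (degree a) _ (ℕ.s≤s |a|≤n) (λ t t≢|a| →
             ∑-walksOfLength-zero t (λ u |u|≡t → ∑-walksOfLength-zero (n ℕ.∸ t) (λ v _ →
               term-zero u v (t≢|a| ∘ trans (sym |u|≡t)))))) ⟩
      ∑ᵗᵘᵛ (term a b) n ∎
      where
      open ≡-Reasoning
      n = degree (a ⊕ b)
      |a|+|b|≡n : degree a ℕ.+ degree b ≡ n
      |a|+|b|≡n = sym (degree-⊕ a b)
      |b|≡n∸|a| : degree b ≡ n ℕ.∸ degree a
      |b|≡n∸|a| = trans (sym (ℕ.m+n∸m≡n (degree a) (degree b))) (cong (ℕ._∸ degree a) |a|+|b|≡n)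
      |a|≤n : degree a ℕ.≤ n
      |a|≤n = subst (degree a ℕ.≤_) |a|+|b|≡n (ℕ.m≤m+n _ _)
      term-zero : ∀ u v → length u ≢ degree a → term a b u v ≡ 0ℚ
      term-zero u v |u|≢|a| rewrite monEq-weightMon-≢ u a |u|≢|a| =
        trans (cong (_* (F u * G v)) (ℚ.*-zeroˡ (𝟙 (monEq (weightMon v) b)))) (ℚ.*-zeroˡ (F u * G v))

    walkSeries-⊛ : (m : Mon d) → (walkSeries F ⊛ walkSeries G) m ≡ walkSeries (λ w → ∑[ x ++ y ≔ w ] F x * G y) m
    walkSeries-⊛ m = begin
      (walkSeries F ⊛ walkSeries G) m
        ≡⟨ ⊛-as-∑ (walkSeries F) (walkSeries G) m ⟩
      ∑[ p ∈ splits m ] walkSeries F (proj₁ p) * walkSeries G (proj₂ p)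
        ≡⟨ ∑-splits-cong m (λ a b a⊕b≡m → trans (walkSeries-* a b) (cong (∑ᵗᵘᵛ (term a b) ∘ degree) a⊕b≡m)) ⟩
      ∑[ p ∈ splits m ] ∑ᵗᵘᵛ (term (proj₁ p) (proj₂ p)) n
        ≡⟨ trans (∑-∑<-swap (splits m) (suc n) (λ p t → ∑[ u ∈ walksOfLength d t ] ∑[ v ∈ walksOfLength d (n ℕ.∸ t) ]
                                                          term (proj₁ p) (proj₂ p) u v))
                 (∑<-cong (suc n) (λ t _ → swap-inner t)) ⟩
      ∑ᵗᵘᵛ (λ u v → 𝟙 (monEq (weightMon u ⊕ weightMon v) m) * (F u * G v)) n
        ≡⟨ sym (∑-walksOfLength-∑++ n _) ⟩
      ∑[ w ∈ walksOfLength d n ] ∑[ x ++ y ≔ w ] 𝟙 (monEq (weightMon x ⊕ weightMon y) m) * (F x * G y)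
        ≡⟨ ∑-cong (walksOfLength d n) (λ w → sym (trans (∑++-*ˡ w (𝟙 (monEq (weightMon w) m)) (λ x y → F x * G y))
             (∑++-cong w (λ x y x++y≡w →
               cong (λ a → 𝟙 (monEq a m) * (F x * G y)) (trans (cong weightMon (sym x++y≡w)) (weightMon-++ x y)))))) ⟩
      walkSeries (λ w → ∑[ x ++ y ≔ w ] F x * G y) m ∎
      where
      open ≡-Reasoning
      n = degree m
      swap-inner : ∀ t →
        ∑[ p ∈ splits m ] ∑[ u ∈ walksOfLength d t ] ∑[ v ∈ walksOfLength d (n ℕ.∸ t) ] term (proj₁ p) (proj₂ p) u v ≡
        ∑[ u ∈ walksOfLength d t ] ∑[ v ∈ walksOfLength d (n ℕ.∸ t) ] 𝟙 (monEq (weightMon u ⊕ weightMon v) m) * (F u * G v)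
      swap-inner t =
        trans (∑-swap (splits m) (walksOfLength d t) _) (∑-cong (walksOfLength d t) (λ u →
        trans (∑-swap (splits m) (walksOfLength d (n ℕ.∸ t)) _) (∑-cong (walksOfLength d (n ℕ.∸ t)) (λ v →
        trans (∑-*ʳ (splits m) (F u * G v) _) (cong (_* (F u * G v)) (∑-splits-𝟙 m (weightMon u) (weightMon v)))))))

  oneS≡walkSeries : (m : Mon d) → oneS m ≡ walkSeries (𝟙 ∘ List.null) m
  oneS≡walkSeries m with degree m in |m|≡n
  ... | zero rewrite degree≡0⇒zeroMon m |m|≡n | monEq-refl (zeroMon d) = refl
  ... | suc n = trans (cong 𝟙 (monEq-≢ m (zeroMon d) m≢0))
    (sym (∑-walksOfLength-zero (suc n) λ { (j ∷ w) _ → ℚ.*-zeroʳ (𝟙 (monEq (weightMon (j ∷ w)) m)) }))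
    where
    m≢0 : m ≢ zeroMon d
    m≢0 m≡0 with () ← trans (sym |m|≡n) (trans (cong degree m≡0) (degree-zeroMon d))

∑-compositions-suc : (i k : ℕ) (f : List ℕ → ℚ) →
  ∑ (compositions i (suc k)) f ≡ ∑[ a < i ] ∑[ c ∈ compositions (i ℕ.∸ suc a) k ] f (suc a ∷ c)
∑-compositions-suc i k f = begin
  ∑ (compositions i (suc k)) f
    ≡⟨ cong (λ cs → ∑ cs f) (unfold i) ⟩
  ∑ (concatMap (λ a → List.map (suc a ∷_) (compositions (i ℕ.∸ suc a) k)) (upTo i)) f
    ≡⟨ ∑-concatMap (λ a → List.map (suc a ∷_) (compositions (i ℕ.∸ suc a) k)) (upTo i) f ⟩
  ∑[ a ∈ upTo i ] ∑ (List.map (suc a ∷_) (compositions (i ℕ.∸ suc a) k)) f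
    ≡⟨ ∑-cong (upTo i) (λ a → ∑-map (suc a ∷_) (compositions (i ℕ.∸ suc a) k) f) ⟩
  ∑[ a ∈ upTo i ] ∑[ c ∈ compositions (i ℕ.∸ suc a) k ] f (suc a ∷ c)
    ≡⟨ ∑-upTo i (λ a → ∑[ c ∈ compositions (i ℕ.∸ suc a) k ] f (suc a ∷ c)) ⟩
  ∑[ a < i ] ∑[ c ∈ compositions (i ℕ.∸ suc a) k ] f (suc a ∷ c) ∎
  where
  open ≡-Reasoning
  unfold : ∀ i → compositions i (suc k) ≡ concatMap (λ a → List.map (suc a ∷_) (compositions (i ℕ.∸ suc a) k)) (upTo i)
  unfold zero    = refl
  unfold (suc i) = refl

-- Positive walks and the cycle lemma

module _ {d : ℕ} (P : Fin d → ℤ) where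

  end : Walk d → ℤ
  end = endpoint P

  end-from : (s : ℤ) (w : Walk d) → List.foldl (λ s j → s ℤ.+ P j) s w ≡ s ℤ.+ end w
  end-from s []      = sym (ℤ.+-identityʳ s)
  end-from s (j ∷ w) = begin
    List.foldl (λ s j → s ℤ.+ P j) (s ℤ.+ P j) w ≡⟨ end-from (s ℤ.+ P j) w ⟩
    s ℤ.+ P j ℤ.+ end w                         ≡⟨ ℤ.+-assoc s (P j) (end w) ⟩
    s ℤ.+ (P j ℤ.+ end w)                       ≡⟨ cong (ℤ._+_ s) (sym (trans (end-from (ℤ.0ℤ ℤ.+ P j) w)
                                                                           (cong (ℤ._+ end w) (ℤ.+-identityˡ (P j))))) ⟩
    s ℤ.+ end (j ∷ w)                           ∎
    where open ≡-Reasoning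

  end-∷ : (j : Fin d) (w : Walk d) → end (j ∷ w) ≡ P j ℤ.+ end w
  end-∷ j w = trans (end-from (ℤ.0ℤ ℤ.+ P j) w) (cong (ℤ._+ end w) (ℤ.+-identityˡ (P j)))

  end-++ : (x y : Walk d) → end (x ++ y) ≡ end x ℤ.+ end y
  end-++ x y = trans (List.foldl-++ (λ s j → s ℤ.+ P j) ℤ.0ℤ x y) (end-from (end x) y)

  end-rotate : (t : ℕ) (w : Walk d) → end (rotate t w) ≡ end w
  end-rotate = rotate-invariant end end-++ ℤ.+-comm

  staysPositiveFrom : ℤ → Walk d → Bool
  staysPositiveFrom s w = allPositive (levelsFrom P s w)

  staysPositiveFrom-++ : (s : ℤ) (x y : Walk d) →
    staysPositiveFrom s (x ++ y) ≡ (staysPositiveFrom s x ∧ staysPositiveFrom (s ℤ.+ end x) y)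
  staysPositiveFrom-++ s []      y = cong (λ s → staysPositiveFrom s y) (sym (ℤ.+-identityʳ s))
  staysPositiveFrom-++ s (j ∷ x) y = begin
    ⌊ ℤ.0ℤ ℤ.<? s ℤ.+ P j ⌋ ∧ staysPositiveFrom (s ℤ.+ P j) (x ++ y)
      ≡⟨ cong (⌊ ℤ.0ℤ ℤ.<? s ℤ.+ P j ⌋ ∧_) (staysPositiveFrom-++ (s ℤ.+ P j) x y) ⟩
    ⌊ ℤ.0ℤ ℤ.<? s ℤ.+ P j ⌋ ∧ (staysPositiveFrom (s ℤ.+ P j) x ∧ staysPositiveFrom (s ℤ.+ P j ℤ.+ end x) y)
      ≡⟨ sym (Bool.∧-assoc ⌊ ℤ.0ℤ ℤ.<? s ℤ.+ P j ⌋ _ _) ⟩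
    staysPositiveFrom s (j ∷ x) ∧ staysPositiveFrom (s ℤ.+ P j ℤ.+ end x) y
      ≡⟨ cong (λ s′ → staysPositiveFrom s (j ∷ x) ∧ staysPositiveFrom s′ y)
              (trans (ℤ.+-assoc s (P j) (end x)) (cong (ℤ._+_ s) (sym (end-∷ j x)))) ⟩
    staysPositiveFrom s (j ∷ x) ∧ staysPositiveFrom (s ℤ.+ end (j ∷ x)) y ∎
    where open ≡-Reasoning

  staysPositiveFrom-∷⁻ : (s : ℤ) (j : Fin d) (w : Walk d) → T (staysPositiveFrom s (j ∷ w)) →
                         ℤ.0ℤ ℤ.< s ℤ.+ P j × T (staysPositiveFrom (s ℤ.+ P j) w)
  staysPositiveFrom-∷⁻ s j w sp with T-∧-elim {⌊ ℤ.0ℤ ℤ.<? s ℤ.+ P j ⌋} sp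
  ... | 0<s+Pj , sp-w = toWitness 0<s+Pj , sp-w

  staysPositiveFrom-∷⁺ : (s : ℤ) (j : Fin d) (w : Walk d) → ℤ.0ℤ ℤ.< s ℤ.+ P j →
                         T (staysPositiveFrom (s ℤ.+ P j) w) → T (staysPositiveFrom s (j ∷ w))
  staysPositiveFrom-∷⁺ s j w 0<s+Pj sp-w = T-∧-intro (fromWitness 0<s+Pj) sp-w

  staysPositiveFrom-mono : {s s′ : ℤ} (w : Walk d) → s ℤ.≤ s′ → T (staysPositiveFrom s w) → T (staysPositiveFrom s′ w)
  staysPositiveFrom-mono []      s≤s′ _  = _
  staysPositiveFrom-mono {s} {s′} (j ∷ w) s≤s′ sp =
    let (0<s+Pj , sp-w) = staysPositiveFrom-∷⁻ s j w sp
        s+Pj≤s′+Pj      = ℤ.+-monoˡ-≤ (P j) s≤s′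
    in staysPositiveFrom-∷⁺ s′ j w (ℤ.<-≤-trans 0<s+Pj s+Pj≤s′+Pj) (staysPositiveFrom-mono w s+Pj≤s′+Pj sp-w)

  staysPositiveFrom⇒0<end : (s : ℤ) (j : Fin d) (w : Walk d) →
    T (staysPositiveFrom s (j ∷ w)) → ℤ.0ℤ ℤ.< s ℤ.+ end (j ∷ w)
  staysPositiveFrom⇒0<end s j []       sp =
    subst (ℤ.0ℤ ℤ.<_) (cong (ℤ._+_ s) (sym (trans (end-∷ j []) (ℤ.+-identityʳ (P j)))))
          (proj₁ (staysPositiveFrom-∷⁻ s j [] sp))
  staysPositiveFrom⇒0<end s j (j′ ∷ w) sp =
    subst (ℤ.0ℤ ℤ.<_) (trans (ℤ.+-assoc s (P j) _) (cong (ℤ._+_ s) (sym (end-∷ j (j′ ∷ w)))))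
          (staysPositiveFrom⇒0<end (s ℤ.+ P j) j′ w (proj₂ (staysPositiveFrom-∷⁻ s j (j′ ∷ w) sp)))

  -- The first conjunct only rules out the empty walk.
  isPositive : Walk d → Bool
  isPositive w = ⌊ ℤ.0ℤ ℤ.<? end w ⌋ ∧ staysPositiveFrom ℤ.0ℤ w

  isPositive⁻ : (w : Walk d) → T (isPositive w) → ℤ.0ℤ ℤ.< end w × T (staysPositiveFrom ℤ.0ℤ w)
  isPositive⁻ w pos with T-∧-elim {⌊ ℤ.0ℤ ℤ.<? end w ⌋} pos
  ... | 0<end , sp = toWitness 0<end , sp

  isPositive⁺ : (w : Walk d) → ℤ.0ℤ ℤ.< end w → T (staysPositiveFrom ℤ.0ℤ w) → T (isPositive w)
  isPositive⁺ w 0<end sp = T-∧-intro (fromWitness 0<end) sp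

  staysPositive⇒isPositive : (j : Fin d) (x : Walk d) → T (staysPositiveFrom ℤ.0ℤ (j ∷ x)) → T (isPositive (j ∷ x))
  staysPositive⇒isPositive j x sp =
    isPositive⁺ (j ∷ x) (subst (ℤ.0ℤ ℤ.<_) (ℤ.+-identityˡ _) (staysPositiveFrom⇒0<end ℤ.0ℤ j x sp)) sp

  isPositive-++⁺ : (x y : Walk d) → T (isPositive x) → T (isPositive y) → T (isPositive (x ++ y))
  isPositive-++⁺ x y pos-x pos-y =
    let (0<x , sp-x) = isPositive⁻ x pos-x
        (0<y , sp-y) = isPositive⁻ y pos-y
    in isPositive⁺ (x ++ y) (subst (ℤ.0ℤ ℤ.<_) (sym (end-++ x y)) (ℤ.+-mono-< 0<x 0<y))
         (subst T (sym (staysPositiveFrom-++ ℤ.0ℤ x y))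
           (T-∧-intro sp-x (staysPositiveFrom-mono y (subst (ℤ.0ℤ ℤ.≤_) (sym (ℤ.+-identityˡ _)) (ℤ.<⇒≤ 0<x)) sp-y)))

  isPositive-prefix : (j : Fin d) (x y : Walk d) → T (isPositive ((j ∷ x) ++ y)) → T (isPositive (j ∷ x))
  isPositive-prefix j x y pos =
    staysPositive⇒isPositive j x
      (proj₁ (T-∧-elim (subst T (staysPositiveFrom-++ ℤ.0ℤ (j ∷ x) y) (proj₂ (isPositive⁻ ((j ∷ x) ++ y) pos)))))

  isPositive-++ : (j : Fin d) (x y : Walk d) → T (isPositive y) → isPositive (j ∷ x) ≡ isPositive ((j ∷ x) ++ y)
  isPositive-++ j x y pos-y = T-⇔⇒≡ (λ pos-x → isPositive-++⁺ (j ∷ x) y pos-x pos-y) (isPositive-prefix j x y)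

  isPositive-swap : (j : Fin d) (x : Walk d) (j′ : Fin d) (y : Walk d) → T (isPositive ((j ∷ x) ++ (j′ ∷ y))) →
                    isPositive ((j′ ∷ y) ++ (j ∷ x)) ≡ isPositive (j′ ∷ y)
  isPositive-swap j x j′ y pos = T-⇔⇒≡ (isPositive-prefix j′ y (j ∷ x))
    (λ pos-y → isPositive-++⁺ (j′ ∷ y) (j ∷ x) pos-y (isPositive-prefix j x (j′ ∷ y) pos))

  NonpositiveSuffixes : Walk d → Set
  NonpositiveSuffixes []      = ⊤
  NonpositiveSuffixes (j ∷ x) = end (j ∷ x) ℤ.≤ ℤ.0ℤ × NonpositiveSuffixes x

  nonpositiveSuffixes⇒end≤0 : (x : Walk d) → NonpositiveSuffixes x → end x ℤ.≤ ℤ.0ℤ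
  nonpositiveSuffixes⇒end≤0 []      _        = ℤ.≤-refl
  nonpositiveSuffixes⇒end≤0 (j ∷ x) (end≤0 , _) = end≤0

  staysPositive-∷ : (s : ℤ) (j : Fin d) (x : Walk d) → NonpositiveSuffixes x →
                    ℤ.0ℤ ℤ.< s ℤ.+ end (j ∷ x) → T (staysPositiveFrom s (j ∷ x))

  nonpositiveSuffixes⇒staysPositive : (s : ℤ) (x : Walk d) → NonpositiveSuffixes x →
                                      ℤ.0ℤ ℤ.< s ℤ.+ end x → T (staysPositiveFrom s x)
  nonpositiveSuffixes⇒staysPositive s []      _        _       = _
  nonpositiveSuffixes⇒staysPositive s (j ∷ x) (_ , ns) 0<s+end = staysPositive-∷ s j x ns 0<s+end

  staysPositive-∷ s j x ns 0<s+end =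
    staysPositiveFrom-∷⁺ s j x 0<s+Pj (nonpositiveSuffixes⇒staysPositive (s ℤ.+ P j) x ns 0<s+Pj+end)
    where
    0<s+Pj+end : ℤ.0ℤ ℤ.< s ℤ.+ P j ℤ.+ end x
    0<s+Pj+end = subst (ℤ.0ℤ ℤ.<_) (trans (cong (ℤ._+_ s) (end-∷ j x)) (sym (ℤ.+-assoc s (P j) (end x)))) 0<s+end
    0<s+Pj : ℤ.0ℤ ℤ.< s ℤ.+ P j
    0<s+Pj = ℤ.<-≤-trans 0<s+Pj+end (subst (s ℤ.+ P j ℤ.+ end x ℤ.≤_) (ℤ.+-identityʳ (s ℤ.+ P j))
                                       (ℤ.+-monoʳ-≤ (s ℤ.+ P j) (nonpositiveSuffixes⇒end≤0 x ns)))

  nonpositive++staysPositive : (w : Walk d) →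
    Σ[ x ∈ Walk d ] Σ[ y ∈ Walk d ] w ≡ x ++ y × NonpositiveSuffixes x × T (staysPositiveFrom ℤ.0ℤ y)
  nonpositive++staysPositive []      = [] , [] , refl , _ , _
  nonpositive++staysPositive (j ∷ w) with nonpositive++staysPositive w
  ... | x , y , refl , ns , sp with end (j ∷ x) ℤ.≤? ℤ.0ℤ
  ...   | yes end≤0 = j ∷ x , y , refl , (end≤0 , ns) , sp
  ...   | no  end≰0 = [] , j ∷ x ++ y , refl , _ ,
    subst T (sym (staysPositiveFrom-++ ℤ.0ℤ (j ∷ x) y))
      (T-∧-intro (staysPositive-∷ ℤ.0ℤ j x ns (subst (ℤ.0ℤ ℤ.<_) (sym (ℤ.+-identityˡ _)) 0<end))
                 (staysPositiveFrom-mono y (ℤ.<⇒≤ (subst (ℤ.0ℤ ℤ.<_) (sym (ℤ.+-identityˡ _)) 0<end)) sp))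
    where
    0<end : ℤ.0ℤ ℤ.< end (j ∷ x)
    0<end = ℤ.≰⇒> end≰0

  positiveRotations : Walk d → ℕ
  positiveRotations = rotationCount isPositive

  -- Cycle lemma: for w = x ++ y as in nonpositive++staysPositive, the rotation y ++ x is positive.
  positiveRotations-pos : (w : Walk d) → ℤ.0ℤ ℤ.< end w → 1 ℕ.≤ positiveRotations w
  positiveRotations-pos w 0<end with nonpositive++staysPositive w
  ... | x , [] , refl , ns , _ =
    ⊥-elim (ℤ.<-irrefl refl (ℤ.<-≤-trans 0<end (subst (ℤ._≤ ℤ.0ℤ) (cong end (sym (List.++-identityʳ x)))
                                                      (nonpositiveSuffixes⇒end≤0 x ns))))
  ... | x , j ∷ y , refl , ns , sp =
    count<-pos (length w) (length x) _ |x|<|w| (subst (T ∘ isPositive) (sym (rotate-length x (j ∷ y))) pos-y++x)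
    where
    |x|<|w| : length x ℕ.< length w
    |x|<|w| = subst (length x ℕ.<_) (sym (List.length-++ x)) (ℕ.m<m+n (length x) ℕ.z<s)
    end-y++x : end ((j ∷ y) ++ x) ≡ end w
    end-y++x = trans (end-++ (j ∷ y) x) (trans (ℤ.+-comm (end (j ∷ y)) (end x)) (sym (end-++ x (j ∷ y))))
    pos-y++x : T (isPositive ((j ∷ y) ++ x))
    pos-y++x = isPositive⁺ ((j ∷ y) ++ x) (subst (ℤ.0ℤ ℤ.<_) (sym end-y++x) 0<end)
      (subst T (sym (staysPositiveFrom-++ ℤ.0ℤ (j ∷ y) x)) (T-∧-intro sp
        (nonpositiveSuffixes⇒staysPositive (ℤ.0ℤ ℤ.+ end (j ∷ y)) x ns
          (subst (ℤ.0ℤ ℤ.<_) (trans (sym end-y++x) (trans (end-++ (j ∷ y) x)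
                                 (cong (ℤ._+ end x) (sym (ℤ.+-identityˡ (end (j ∷ y))))))) 0<end))))

  positiveProperSuffixes : Walk d → ℕ
  positiveProperSuffixes w = suffixCount isPositive (drop 1 w)

  -- The positive rotations of a positive walk are itself and its rotations starting at its
  -- positive proper suffixes.
  suc-positiveProperSuffixes : (w : Walk d) → T (isPositive w) → suc (positiveProperSuffixes w) ≡ positiveRotations w
  suc-positiveProperSuffixes (j ∷ v) pos = begin
    suc (suffixCount isPositive v)
      ≡⟨ cong suc (suffixCount-count< isPositive v) ⟩
    suc (count< (length v) (λ s → isPositive (drop s v)))
      ≡⟨ cong suc (count<-cong (length v) (λ s s<|v| → sym (rotate-suc s s<|v|))) ⟩
    suc (count< (length v) (λ s → isPositive (rotate (suc s) (j ∷ v))))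
      ≡⟨ cong (λ b → boolToℕ b ℕ.+ count< (length v) (λ s → isPositive (rotate (suc s) (j ∷ v))))
              (sym (T⇒≡true (subst (T ∘ isPositive) (sym (List.++-identityʳ (j ∷ v))) pos))) ⟩
    positiveRotations (j ∷ v) ∎
    where
    open ≡-Reasoning
    rotate-suc : ∀ s → s ℕ.< length v → isPositive (rotate (suc s) (j ∷ v)) ≡ isPositive (drop s v)
    rotate-suc s s<|v| with drop-<-length s v s<|v|
    ... | j′ , y , drop≡ = subst (λ u → isPositive (u ++ j ∷ take s v) ≡ isPositive u) (sym drop≡)
      (isPositive-swap j (take s v) j′ y
        (subst (T ∘ isPositive ∘ (j ∷_)) (sym (trans (cong (take s v ++_) (sym drop≡)) (List.take++drop≡id s v))) pos))

  -- The contribution of a walk to the left-hand side (∑<-sign*factorizations).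
  logWeight : Walk d → ℚ
  logWeight w = 𝟙 (isPositive w) * 1/[1+ positiveProperSuffixes w ]

  ∑-logWeight-rotate : (w : Walk d) → ℤ.0ℤ ℤ.< end w → ∑[ t < length w ] logWeight (rotate t w) ≡ 1ℚ
  ∑-logWeight-rotate w 0<end = begin
    ∑[ t < length w ] logWeight (rotate t w)
      ≡⟨ ∑<-cong (length w) (λ t _ → 𝟙*-cong (isPositive (rotate t w)) (cong 1/[1+_] ∘ suffixes≡r t)) ⟩
    ∑[ t < length w ] 𝟙 (isPositive (rotate t w)) * 1/[1+ r ]
      ≡⟨ ∑<-*ʳ (length w) 1/[1+ r ] (λ t → 𝟙 (isPositive (rotate t w))) ⟩
    (∑[ t < length w ] 𝟙 (isPositive (rotate t w))) * 1/[1+ r ]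
      ≡⟨ cong (_* 1/[1+ r ]) (trans (∑<-𝟙 (length w) (λ t → isPositive (rotate t w))) (cong fromℕ rotations≡1+r)) ⟩
    fromℕ (suc r) * 1/[1+ r ]
      ≡⟨ trans (ℚ.*-comm (fromℕ (suc r)) 1/[1+ r ]) (1/[1+n]*[1+n]≡1 r) ⟩
    1ℚ ∎
    where
    open ≡-Reasoning
    r = ℕ.pred (positiveRotations w)
    rotations≡1+r : positiveRotations w ≡ suc r
    rotations≡1+r = sym (ℕ.suc-pred (positiveRotations w) {{ℕ.>-nonZero (positiveRotations-pos w 0<end)}})
    suffixes≡r : ∀ t → T (isPositive (rotate t w)) → positiveProperSuffixes (rotate t w) ≡ r
    suffixes≡r t pos = ℕ.suc-injective (trans (suc-positiveProperSuffixes (rotate t w) pos)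
                                         (trans (rotationCount-rotate isPositive t w) rotations≡1+r))

  ∑-walksOfLength-*logWeight : (n : ℕ) (ψ : Walk d → ℚ) → (∀ t w → ψ (rotate t w) ≡ ψ w) →
    (∀ w → end w ℤ.≤ ℤ.0ℤ → ψ w ≡ 0ℚ) →
    ∑[ w ∈ walksOfLength d (suc n) ] ψ w * logWeight w ≡ 1/[1+ n ] * ∑ (walksOfLength d (suc n)) ψ
  ∑-walksOfLength-*logWeight n ψ ψ-rotate ψ-vanishes = begin
    Σ                                        ≡⟨ sym (trans (cong (_* Σ) (1/[1+n]*[1+n]≡1 n)) (ℚ.*-identityˡ Σ)) ⟩
    (1/[1+ n ] * fromℕ (suc n)) * Σ          ≡⟨ ℚ.*-assoc 1/[1+ n ] (fromℕ (suc n)) Σ ⟩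
    1/[1+ n ] * (fromℕ (suc n) * Σ)          ≡⟨ cong (1/[1+ n ] *_) averaged ⟩
    1/[1+ n ] * ∑ (walksOfLength d (suc n)) ψ ∎
    where
    open ≡-Reasoning
    Σ = ∑[ w ∈ walksOfLength d (suc n) ] ψ w * logWeight w
    ψ-*-∑-logWeight-rotate : ∀ w → length w ≡ suc n → Dec (ℤ.0ℤ ℤ.< end w) →
                             ψ w * (∑[ t < suc n ] logWeight (rotate t w)) ≡ ψ w
    ψ-*-∑-logWeight-rotate w |w|≡1+n (yes 0<end) =
      trans (cong (λ k → ψ w * (∑[ t < k ] logWeight (rotate t w))) (sym |w|≡1+n))
            (trans (cong (ψ w *_) (∑-logWeight-rotate w 0<end)) (ℚ.*-identityʳ (ψ w)))
    ψ-*-∑-logWeight-rotate w _ (no 0≮end) =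
      trans (cong (_* (∑[ t < suc n ] logWeight (rotate t w))) ψw≡0)
            (trans (ℚ.*-zeroˡ (∑[ t < suc n ] logWeight (rotate t w))) (sym ψw≡0))
      where
      ψw≡0 : ψ w ≡ 0ℚ
      ψw≡0 = ψ-vanishes w (ℤ.≮⇒≥ 0≮end)
    averaged : fromℕ (suc n) * Σ ≡ ∑ (walksOfLength d (suc n)) ψ
    averaged = begin
      fromℕ (suc n) * Σ
        ≡⟨ sym (∑<-const (suc n) Σ) ⟩
      ∑[ t < suc n ] Σ
        ≡⟨ ∑<-cong (suc n) (λ t t<1+n →
             trans (sym (∑-walksOfLength-rotate (suc n) t (λ w → ψ w * logWeight w) (ℕ.<⇒≤ t<1+n)))
             (∑-cong (walksOfLength d (suc n)) (λ w → cong (_* logWeight (rotate t w)) (ψ-rotate t w)))) ⟩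
      ∑[ t < suc n ] ∑[ w ∈ walksOfLength d (suc n) ] ψ w * logWeight (rotate t w)
        ≡⟨ sym (∑-∑<-swap (walksOfLength d (suc n)) (suc n) (λ w t → ψ w * logWeight (rotate t w))) ⟩
      ∑[ w ∈ walksOfLength d (suc n) ] ∑[ t < suc n ] ψ w * logWeight (rotate t w)
        ≡⟨ ∑-walksOfLength-cong (suc n) (λ w |w|≡1+n →
             trans (∑<-*ˡ (suc n) (ψ w) (λ t → logWeight (rotate t w)))
                   (ψ-*-∑-logWeight-rotate w |w|≡1+n (ℤ.0ℤ ℤ.<? end w))) ⟩
      ∑ (walksOfLength d (suc n)) ψ ∎

  -- The two sides as sums over walks

  S≡walkSeries : (i : ℕ) (m : Mon d) → S P i m ≡ walkSeries (𝟙 ∘ isPositiveWalkTo P i) m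
  S≡walkSeries i m = trans (sumℚ-map _ (walksOfLength d (degree m))) (∑-cong (walksOfLength d (degree m)) (λ w →
    trans (𝟙-∧ (isPositiveWalkTo P i w) (monEq (weightMon w) m)) (ℚ.*-comm (𝟙 (isPositiveWalkTo P i w)) _)))

  factorizationsWithEnds : List ℕ → Walk d → ℚ
  factorizationsWithEnds []      w = 𝟙 (List.null w)
  factorizationsWithEnds (i ∷ c) w = ∑[ x ++ y ≔ w ] 𝟙 (isPositiveWalkTo P i x) * factorizationsWithEnds c y

  prodS≡walkSeries : (c : List ℕ) (m : Mon d) → prodS (List.map (S P) c) m ≡ walkSeries (factorizationsWithEnds c) m
  prodS≡walkSeries []      m = oneS≡walkSeries m
  prodS≡walkSeries (i ∷ c) m =
    trans (⊛-cong (S≡walkSeries i) (prodS≡walkSeries c) m)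
          (walkSeries-⊛ (𝟙 ∘ isPositiveWalkTo P i) (factorizationsWithEnds c) m)

  factorizations-vanishes : (k : ℕ) (w : Walk d) → end w ℤ.< ℤ.+ k → factorizations isPositive k w ≡ 0ℚ
  factorizations-vanishes zero    []      end<0 = ⊥-elim (ℤ.<-irrefl refl end<0)
  factorizations-vanishes zero    (j ∷ w) _     = refl
  factorizations-vanishes (suc k) w       end<1+k = ∑++-zero w (λ x y x++y≡w → 𝟙*-zero (isPositive x) (λ pos-x →
    factorizations-vanishes k y (0<i⇒i+j<1+k⇒j<k k (proj₁ (isPositive⁻ x pos-x))
      (subst (ℤ._< ℤ.+ suc k) (trans (cong end (sym x++y≡w)) (end-++ x y)) end<1+k))))

  ∑<-isPositiveWalkTo : (i : ℕ) (x y : Walk d) → ℤ.0ℤ ℤ.≤ end y →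
    ∑[ a < i ] 𝟙 (isPositiveWalkTo P (suc a) x) * 𝟙 ⌊ end y ℤ.≟ ℤ.+ (i ℕ.∸ suc a) ⌋ ≡
    𝟙 (isPositive x) * 𝟙 ⌊ end (x ++ y) ℤ.≟ ℤ.+ i ⌋
  ∑<-isPositiveWalkTo i x y 0≤end = begin
    ∑[ a < i ] 𝟙 (isPositiveWalkTo P (suc a) x) * 𝟙 ⌊ end y ℤ.≟ ℤ.+ (i ℕ.∸ suc a) ⌋
      ≡⟨ ∑<-cong i (λ a _ → trans (cong (_* 𝟙 ⌊ end y ℤ.≟ ℤ.+ (i ℕ.∸ suc a) ⌋) (𝟙-∧ ⌊ end x ℤ.≟ ℤ.+ suc a ⌋ sp))
                                  (xy∙z≈y∙xz (𝟙 ⌊ end x ℤ.≟ ℤ.+ suc a ⌋) (𝟙 sp) _)) ⟩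
    ∑[ a < i ] 𝟙 sp * (𝟙 ⌊ end x ℤ.≟ ℤ.+ suc a ⌋ * 𝟙 ⌊ end y ℤ.≟ ℤ.+ (i ℕ.∸ suc a) ⌋)
      ≡⟨ ∑<-*ˡ i (𝟙 sp) _ ⟩
    𝟙 sp * (∑[ a < i ] 𝟙 ⌊ end x ℤ.≟ ℤ.+ suc a ⌋ * 𝟙 ⌊ end y ℤ.≟ ℤ.+ (i ℕ.∸ suc a) ⌋)
      ≡⟨ cong (𝟙 sp *_) (∑<-𝟙≟ℤ-𝟙≟ℤ i (end x) (end y) 0≤end) ⟩
    𝟙 sp * (𝟙 ⌊ ℤ.0ℤ ℤ.<? end x ⌋ * 𝟙 ⌊ end x ℤ.+ end y ℤ.≟ ℤ.+ i ⌋)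
      ≡⟨ x∙yz≈yx∙z (𝟙 sp) (𝟙 ⌊ ℤ.0ℤ ℤ.<? end x ⌋) _ ⟩
    (𝟙 ⌊ ℤ.0ℤ ℤ.<? end x ⌋ * 𝟙 sp) * 𝟙 ⌊ end x ℤ.+ end y ℤ.≟ ℤ.+ i ⌋
      ≡⟨ cong₂ _*_ (sym (𝟙-∧ ⌊ ℤ.0ℤ ℤ.<? end x ⌋ sp)) (cong (λ e → 𝟙 ⌊ e ℤ.≟ ℤ.+ i ⌋) (sym (end-++ x y))) ⟩
    𝟙 (isPositive x) * 𝟙 ⌊ end (x ++ y) ℤ.≟ ℤ.+ i ⌋ ∎
    where
    open ≡-Reasoning
    sp = staysPositiveFrom ℤ.0ℤ x

  ∑-compositions-factorizationsWithEnds : (k i : ℕ) (w : Walk d) →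
    ∑[ c ∈ compositions i k ] factorizationsWithEnds c w ≡ 𝟙 ⌊ end w ℤ.≟ ℤ.+ i ⌋ * factorizations isPositive k w
  ∑-compositions-factorizationsWithEnds zero zero    []      = refl
  ∑-compositions-factorizationsWithEnds zero zero    (j ∷ w) =
    trans (ℚ.+-identityʳ 0ℚ) (sym (ℚ.*-zeroʳ (𝟙 ⌊ end (j ∷ w) ℤ.≟ ℤ.+ 0 ⌋)))
  ∑-compositions-factorizationsWithEnds zero (suc i) []      = refl
  ∑-compositions-factorizationsWithEnds zero (suc i) (j ∷ w) = sym (ℚ.*-zeroʳ (𝟙 ⌊ end (j ∷ w) ℤ.≟ ℤ.+ suc i ⌋))
  ∑-compositions-factorizationsWithEnds (suc k) i w = begin
    ∑[ c ∈ compositions i (suc k) ] factorizationsWithEnds c w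
      ≡⟨ ∑-compositions-suc i k (λ c → factorizationsWithEnds c w) ⟩
    ∑[ a < i ] ∑[ c ∈ compositions (i ℕ.∸ suc a) k ]
      ∑[ x ++ y ≔ w ] 𝟙 (isPositiveWalkTo P (suc a) x) * factorizationsWithEnds c y
      ≡⟨ ∑<-cong i (λ a _ → trans (∑-∑++-swap (compositions (i ℕ.∸ suc a) k) w _) (∑++-cong w (λ x y _ →
           trans (∑-*ˡ (compositions (i ℕ.∸ suc a) k) (𝟙 (isPositiveWalkTo P (suc a) x)) (λ c → factorizationsWithEnds c y))
                 (cong (𝟙 (isPositiveWalkTo P (suc a) x) *_) (∑-compositions-factorizationsWithEnds k (i ℕ.∸ suc a) y))))) ⟩
    ∑[ a < i ] ∑[ x ++ y ≔ w ] 𝟙 (isPositiveWalkTo P (suc a) x) * (𝟙 ⌊ end y ℤ.≟ ℤ.+ (i ℕ.∸ suc a) ⌋ * F y)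
      ≡⟨ ∑<-∑++-swap i w _ ⟩
    ∑[ x ++ y ≔ w ] ∑[ a < i ] 𝟙 (isPositiveWalkTo P (suc a) x) * (𝟙 ⌊ end y ℤ.≟ ℤ.+ (i ℕ.∸ suc a) ⌋ * F y)
      ≡⟨ ∑++-cong w (λ x y x++y≡w → split-end x y x++y≡w (ℤ.0ℤ ℤ.≤? end y)) ⟩
    ∑[ x ++ y ≔ w ] 𝟙 ⌊ end w ℤ.≟ ℤ.+ i ⌋ * (𝟙 (isPositive x) * F y)
      ≡⟨ sym (∑++-*ˡ w (𝟙 ⌊ end w ℤ.≟ ℤ.+ i ⌋) _) ⟩
    𝟙 ⌊ end w ℤ.≟ ℤ.+ i ⌋ * factorizations isPositive (suc k) w ∎
    where
    open ≡-Reasoning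
    F = factorizations isPositive k
    split-end : ∀ x y → x ++ y ≡ w → Dec (ℤ.0ℤ ℤ.≤ end y) →
      ∑[ a < i ] 𝟙 (isPositiveWalkTo P (suc a) x) * (𝟙 ⌊ end y ℤ.≟ ℤ.+ (i ℕ.∸ suc a) ⌋ * F y) ≡
      𝟙 ⌊ end w ℤ.≟ ℤ.+ i ⌋ * (𝟙 (isPositive x) * F y)
    split-end x y x++y≡w (yes 0≤end) = begin
      ∑[ a < i ] 𝟙 (isPositiveWalkTo P (suc a) x) * (𝟙 ⌊ end y ℤ.≟ ℤ.+ (i ℕ.∸ suc a) ⌋ * F y)
        ≡⟨ trans (∑<-cong i (λ a _ →
                   sym (ℚ.*-assoc (𝟙 (isPositiveWalkTo P (suc a) x)) (𝟙 ⌊ end y ℤ.≟ ℤ.+ (i ℕ.∸ suc a) ⌋) (F y))))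
                 (∑<-*ʳ i (F y) (λ a → 𝟙 (isPositiveWalkTo P (suc a) x) * 𝟙 ⌊ end y ℤ.≟ ℤ.+ (i ℕ.∸ suc a) ⌋)) ⟩
      (∑[ a < i ] 𝟙 (isPositiveWalkTo P (suc a) x) * 𝟙 ⌊ end y ℤ.≟ ℤ.+ (i ℕ.∸ suc a) ⌋) * F y
        ≡⟨ cong (_* F y) (∑<-isPositiveWalkTo i x y 0≤end) ⟩
      (𝟙 (isPositive x) * 𝟙 ⌊ end (x ++ y) ℤ.≟ ℤ.+ i ⌋) * F y
        ≡⟨ trans (xy∙z≈y∙xz (𝟙 (isPositive x)) _ (F y))
                 (cong (λ v → 𝟙 ⌊ end v ℤ.≟ ℤ.+ i ⌋ * (𝟙 (isPositive x) * F y)) x++y≡w) ⟩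
      𝟙 ⌊ end w ℤ.≟ ℤ.+ i ⌋ * (𝟙 (isPositive x) * F y) ∎
    split-end x y _ (no 0≰end) =
      trans (∑<-zero i (λ a _ → *[*Fy]≡0 (𝟙 (isPositiveWalkTo P (suc a) x)) (𝟙 ⌊ end y ℤ.≟ ℤ.+ (i ℕ.∸ suc a) ⌋)))
            (sym (*[*Fy]≡0 (𝟙 ⌊ end w ℤ.≟ ℤ.+ i ⌋) (𝟙 (isPositive x))))
      where
      Fy≡0 : F y ≡ 0ℚ
      Fy≡0 = factorizations-vanishes k y (ℤ.<-≤-trans (ℤ.≰⇒> 0≰end) (ℤ.+≤+ ℕ.z≤n))
      *[*Fy]≡0 : ∀ a b → a * (b * F y) ≡ 0ℚ
      *[*Fy]≡0 a b = trans (cong (λ v → a * (b * v)) Fy≡0) (trans (cong (a *_) (ℚ.*-zeroʳ b)) (ℚ.*-zeroʳ a))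

  factorizations-isPositive-suc : (k : ℕ) (w : Walk d) →
    factorizations isPositive (suc k) w ≡ 𝟙 (isPositive w) * binomial (positiveProperSuffixes w) k
  factorizations-isPositive-suc = factorizations-suc isPositive (λ ()) isPositive-++

  ∑<-sign*factorizations : (i : ℕ) (w : Walk d) → end w ≡ ℤ.+ suc i →
    ∑[ k < suc i ] sign k * 1/[1+ k ] * factorizations isPositive (suc k) w ≡ logWeight w
  ∑<-sign*factorizations i w end≡1+i = begin
    ∑< (suc i) f
      ≡⟨ sym (ℚ.+-identityʳ _) ⟩
    ∑< (suc i) f + 0ℚ
      ≡⟨ cong (∑< (suc i) f +_) (sym (∑<-zero (length w) (λ t _ → beyond-end (suc i ℕ.+ t) (ℕ.m≤m+n (suc i) t)))) ⟩
    ∑< (suc i) f + (∑[ t < length w ] f (suc i ℕ.+ t))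
      ≡⟨ sym (∑<-+ (suc i) (length w) f) ⟩
    ∑< N f
      ≡⟨ ∑<-cong N (λ k _ → trans (cong (sign k * 1/[1+ k ] *_) (factorizations-isPositive-suc k w))
                                 (*-left-comm (sign k * 1/[1+ k ]) (𝟙 (isPositive w)) _)) ⟩
    ∑[ k < N ] 𝟙 (isPositive w) * (sign k * 1/[1+ k ] * binomial (positiveProperSuffixes w) k)
      ≡⟨ ∑<-*ˡ N (𝟙 (isPositive w)) (λ k → sign k * 1/[1+ k ] * binomial (positiveProperSuffixes w) k) ⟩
    𝟙 (isPositive w) * (∑[ k < N ] sign k * 1/[1+ k ] * binomial (positiveProperSuffixes w) k)
      ≡⟨ cong (𝟙 (isPositive w) *_) (∑-sign*binomial/[1+k] (positiveProperSuffixes w) N suffixes<N) ⟩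
    logWeight w ∎
    where
    open ≡-Reasoning
    N = suc i ℕ.+ length w
    f : ℕ → ℚ
    f k = sign k * 1/[1+ k ] * factorizations isPositive (suc k) w
    beyond-end : ∀ k → suc i ℕ.≤ k → f k ≡ 0ℚ
    beyond-end k 1+i≤k = trans (cong (sign k * 1/[1+ k ] *_)
      (factorizations-vanishes (suc k) w (subst (ℤ._< ℤ.+ suc k) (sym end≡1+i) (ℤ.+<+ (ℕ.s≤s 1+i≤k)))))
      (ℚ.*-zeroʳ (sign k * 1/[1+ k ]))
    suffixes<N : positiveProperSuffixes w ℕ.< N
    suffixes<N = ℕ.s≤s (ℕ.≤-trans (suffixCount-≤ isPositive (drop 1 w))
      (ℕ.≤-trans (ℕ.≤-reflexive (List.length-drop 1 w)) (ℕ.≤-trans (ℕ.m∸n≤m (length w) 1) (ℕ.m≤n+m (length w) i))))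

  private
    Term : Set
    Term = ℚ × Mon d × ℤ

    _·_ : Term → Term → Term
    (c , m , e) · (c′ , m′ , e′) = c * c′ , m ⊕ m′ , e ℤ.+ e′

    stepTerm : Fin d → Term
    stepTerm j = 1ℚ , unitMon j , P j

  ∑-stepPoly^P : (k : ℕ) (h : Term → ℚ) →
                 ∑ (stepPoly P ^P k) h ≡ ∑[ w ∈ walksOfLength d k ] h (1ℚ , weightMon w , end w)
  ∑-stepPoly^P zero    h = refl
  ∑-stepPoly^P (suc k) h = begin
    ∑ (stepPoly P ⊗ (stepPoly P ^P k)) h
      ≡⟨ cong (λ ts → ∑ ts h) (List.concatMap-cong
           (λ { (c , m , e) → List.map-cong (λ { (c′ , m′ , e′) → refl }) (stepPoly P ^P k) }) (stepPoly P)) ⟩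
    ∑ (concatMap (λ t → List.map (t ·_) (stepPoly P ^P k)) (List.map stepTerm (allFin d))) h
      ≡⟨ ∑-concatMap (λ t → List.map (t ·_) (stepPoly P ^P k)) (List.map stepTerm (allFin d)) h ⟩
    ∑[ t ∈ List.map stepTerm (allFin d) ] ∑ (List.map (t ·_) (stepPoly P ^P k)) h
      ≡⟨ ∑-map stepTerm (allFin d) _ ⟩
    ∑[ j ∈ allFin d ] ∑ (List.map (stepTerm j ·_) (stepPoly P ^P k)) h
      ≡⟨ ∑-cong (allFin d) (λ j → trans (∑-map (stepTerm j ·_) (stepPoly P ^P k) h)
                                         (∑-stepPoly^P k (h ∘ (stepTerm j ·_)))) ⟩
    ∑[ j ∈ allFin d ] ∑[ w ∈ walksOfLength d k ] h (1ℚ * 1ℚ , unitMon j ⊕ weightMon w , P j ℤ.+ end w)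
      ≡⟨ ∑-cong (allFin d) (λ j → ∑-cong (walksOfLength d k) (λ w → cong h (cong₂ _,_ (ℚ.*-identityˡ 1ℚ)
           (cong₂ _,_ (sym (updateAt-suc≡unitMon-⊕ j (weightMon w))) (sym (end-∷ j w)))))) ⟩
    ∑[ j ∈ allFin d ] ∑[ w ∈ walksOfLength d k ] h (1ℚ , weightMon (j ∷ w) , end (j ∷ w))
      ≡⟨ sym (∑-walksOfLength-suc k (λ w → h (1ℚ , weightMon w , end w))) ⟩
    ∑[ w ∈ walksOfLength d (suc k) ] h (1ℚ , weightMon w , end w) ∎
    where open ≡-Reasoning

  endsAtWithWeight : ℕ → Mon d → Walk d → Bool
  endsAtWithWeight i m w = monEq (weightMon w) m ∧ ⌊ end w ℤ.≟ ℤ.+ i ⌋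

  logCoeff≡∑ : (i : ℕ) (m : Mon d) →
    logCoeff P i m ≡ ∑[ n < degree m ] 1/[1+ n ] * (∑[ w ∈ walksOfLength d (suc n) ] 𝟙 (endsAtWithWeight i m w))
  logCoeff≡∑ i m = trans (sumℚ-map _ (upTo (degree m))) (trans (∑-upTo (degree m) _) (∑<-cong (degree m) (λ n _ →
    cong (1/[1+ n ] *_) (trans (sumℚ-map _ (stepPoly P ^P suc n))
      (trans (∑-cong (stepPoly P ^P suc n) (λ { (c , m′ , e′) → refl })) (∑-stepPoly^P (suc n) coefficient))))))
    where
    coefficient : Term → ℚ
    coefficient (c , m′ , e′) = if monEq m′ m ∧ ⌊ e′ ℤ.≟ ℤ.+ i ⌋ then c else 0ℚ

  endsAtWithWeight⇒end : (i : ℕ) (m : Mon d) (w : Walk d) → T (endsAtWithWeight i m w) → end w ≡ ℤ.+ i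
  endsAtWithWeight⇒end i m w t = toWitness (proj₂ (T-∧-elim {monEq (weightMon w) m} t))

  endsAtWithWeight-rotate : (i : ℕ) (m : Mon d) (t : ℕ) (w : Walk d) →
                            endsAtWithWeight i m (rotate t w) ≡ endsAtWithWeight i m w
  endsAtWithWeight-rotate i m t w =
    cong₂ (λ a e → monEq a m ∧ ⌊ e ℤ.≟ ℤ.+ i ⌋) (weightMon-rotate t w) (end-rotate t w)

  ∑-compositions-prodS : (i k : ℕ) (m : Mon d) →
    ∑[ c ∈ compositions i k ] prodS (List.map (S P) c) m ≡
    ∑[ w ∈ walksOfLength d (degree m) ] 𝟙 (endsAtWithWeight i m w) * factorizations isPositive k w
  ∑-compositions-prodS i k m = begin
    ∑[ c ∈ compositions i k ] prodS (List.map (S P) c) m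
      ≡⟨ ∑-cong (compositions i k) (λ c → prodS≡walkSeries c m) ⟩
    ∑[ c ∈ compositions i k ] ∑[ w ∈ walksOfLength d (degree m) ] 𝟙 (monEq (weightMon w) m) * factorizationsWithEnds c w
      ≡⟨ ∑-swap (compositions i k) (walksOfLength d (degree m)) _ ⟩
    ∑[ w ∈ walksOfLength d (degree m) ] ∑[ c ∈ compositions i k ] 𝟙 (monEq (weightMon w) m) * factorizationsWithEnds c w
      ≡⟨ ∑-cong (walksOfLength d (degree m)) (λ w →
           trans (∑-*ˡ (compositions i k) (𝟙 (monEq (weightMon w) m)) (λ c → factorizationsWithEnds c w))
           (trans (cong (𝟙 (monEq (weightMon w) m) *_) (∑-compositions-factorizationsWithEnds k i w))
           (trans (sym (ℚ.*-assoc (𝟙 (monEq (weightMon w) m)) _ _))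
                  (cong (_* factorizations isPositive k w) (sym (𝟙-∧ (monEq (weightMon w) m) ⌊ end w ℤ.≟ ℤ.+ i ⌋)))))) ⟩
    ∑[ w ∈ walksOfLength d (degree m) ] 𝟙 (endsAtWithWeight i m w) * factorizations isPositive k w ∎
    where open ≡-Reasoning

  lhsSeries≡∑ : (i : ℕ) (m : Mon d) →
    lhsSeries P (suc i) m ≡ ∑[ w ∈ walksOfLength d (degree m) ] 𝟙 (endsAtWithWeight (suc i) m w) * logWeight w
  lhsSeries≡∑ i m = begin
    lhsSeries P (suc i) m
      ≡⟨ trans (sumℚ-map summand (upTo (suc i))) (∑-upTo (suc i) summand) ⟩
    ∑[ k < suc i ] summand k
      ≡⟨ ∑<-cong (suc i) (λ k _ → cong (sign k * 1/[1+ k ] *_)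
           (trans (sumℚ-map (λ c → prodS (List.map (S P) c) m) (compositions (suc i) (suc k)))
                  (∑-compositions-prodS (suc i) (suc k) m))) ⟩
    ∑[ k < suc i ] sign k * 1/[1+ k ] * (∑[ w ∈ walks ] χ w * F (suc k) w)
      ≡⟨ ∑<-cong (suc i) (λ k _ → trans (sym (∑-*ˡ walks (sign k * 1/[1+ k ]) (λ w → χ w * F (suc k) w)))
           (∑-cong walks (λ w → *-left-comm (sign k * 1/[1+ k ]) (χ w) (F (suc k) w)))) ⟩
    ∑[ k < suc i ] ∑[ w ∈ walks ] χ w * (sign k * 1/[1+ k ] * F (suc k) w)
      ≡⟨ sym (∑-∑<-swap walks (suc i) (λ w k → χ w * (sign k * 1/[1+ k ] * F (suc k) w))) ⟩
    ∑[ w ∈ walks ] ∑[ k < suc i ] χ w * (sign k * 1/[1+ k ] * F (suc k) w)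
      ≡⟨ ∑-cong walks (λ w → trans (∑<-*ˡ (suc i) (χ w) (λ k → sign k * 1/[1+ k ] * F (suc k) w))
           (𝟙*-cong (endsAtWithWeight (suc i) m w) (∑<-sign*factorizations i w ∘ endsAtWithWeight⇒end (suc i) m w))) ⟩
    ∑[ w ∈ walks ] χ w * logWeight w ∎
    where
    open ≡-Reasoning
    walks = walksOfLength d (degree m)
    χ = 𝟙 ∘ endsAtWithWeight (suc i) m
    F = factorizations isPositive
    summand : ℕ → ℚ
    summand k = sign k * 1/[1+ k ] * sumℚ (List.map (λ c → prodS (List.map (S P) c) m) (compositions (suc i) (suc k)))

  ∑-𝟙endsAtWithWeight*logWeight : (i : ℕ) (m : Mon d) →
    ∑[ w ∈ walksOfLength d (degree m) ] 𝟙 (endsAtWithWeight (suc i) m w) * logWeight w ≡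
    ∑[ n < degree m ] 1/[1+ n ] * (∑[ w ∈ walksOfLength d (suc n) ] 𝟙 (endsAtWithWeight (suc i) m w))
  ∑-𝟙endsAtWithWeight*logWeight i m = by-degree (degree m) refl
    where
    χ = 𝟙 ∘ endsAtWithWeight (suc i) m
    by-degree : ∀ n → degree m ≡ n →
      ∑[ w ∈ walksOfLength d n ] χ w * logWeight w ≡ ∑[ n′ < n ] 1/[1+ n′ ] * ∑ (walksOfLength d (suc n′)) χ
    by-degree zero    _ =
      trans (cong (_+ 0ℚ) (trans (cong (χ [] *_) (ℚ.*-zeroˡ 1/[1+ 0 ])) (ℚ.*-zeroʳ (χ [])))) (ℚ.+-identityʳ 0ℚ)
    by-degree (suc n) |m|≡1+n = begin
      ∑[ w ∈ walksOfLength d (suc n) ] χ w * logWeight w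
        ≡⟨ ∑-walksOfLength-*logWeight n χ (λ t w → cong 𝟙 (endsAtWithWeight-rotate (suc i) m t w))
             (λ w end≤0 → 𝟙-¬T (λ t →
               ℤ.<⇒≱ (ℤ.+<+ ℕ.z<s) (subst (ℤ._≤ ℤ.0ℤ) (endsAtWithWeight⇒end (suc i) m w t) end≤0))) ⟩
      1/[1+ n ] * ∑ (walksOfLength d (suc n)) χ
        ≡⟨ sym (∑<-delta (suc n) n _ ℕ.≤-refl (λ n′ n′≢n → trans (cong (1/[1+ n′ ] *_)
             (∑-walksOfLength-zero (suc n′) (λ w |w|≡1+n′ → cong (λ b → 𝟙 (b ∧ ⌊ end w ℤ.≟ ℤ.+ suc i ⌋))
               (monEq-weightMon-≢ w m (λ |w|≡|m| →
                 n′≢n (ℕ.suc-injective (trans (sym |w|≡1+n′) (trans |w|≡|m| |m|≡1+n))))))))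
             (ℚ.*-zeroʳ 1/[1+ n′ ]))) ⟩
      ∑[ n′ < suc n ] 1/[1+ n′ ] * ∑ (walksOfLength d (suc n′)) χ ∎
      where open ≡-Reasoning

proposition4p3 : (d : ℕ) (P : Fin d → ℤ) → (∀ a b → P a ≡ P b → a ≡ b) →
    (i : ℕ) → i ≥ 1 → (m : Mon d) → lhsSeries P i m ≡ logCoeff P i m
proposition4p3 d P _ (suc i) _ m = begin
  lhsSeries P (suc i) m
    ≡⟨ lhsSeries≡∑ P i m ⟩
  ∑[ w ∈ walksOfLength d (degree m) ] 𝟙 (endsAtWithWeight P (suc i) m w) * logWeight P w
    ≡⟨ ∑-𝟙endsAtWithWeight*logWeight P i m ⟩
  ∑[ n < degree m ] 1/[1+ n ] * (∑[ w ∈ walksOfLength d (suc n) ] 𝟙 (endsAtWithWeight P (suc i) m w))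
    ≡⟨ sym (logCoeff≡∑ P (suc i) m) ⟩
  logCoeff P (suc i) m ∎
  where open ≡-Reasoning
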